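{- Let $G=C_p\,\square\,P_q$ with $p\geq 4$ even and $q\geq 1$. Then $G$ admits an acyclic $T$-odd orientation for every subset $T\subseteq V(G)$ satisfying $\mathcal{P}$, $\mathcal{S}$ and $\overline{\mathcal{S}}$.
   Context: Graphs are finite and simple; $d(v)$ is degree; $C_p$ is the cycle on $p$ vertices, $P_q$ the path on $q$ vertices, $\square$ the Cartesian product. An orientation is $T$-odd if every vertex $v$ has odd in-degree iff $v\in T$; acyclic means no directed cycle. $Source(T)=V(G)\setminus T$, $Sink(T)=\{v\in T: d(v)\text{ odd}\}\cup\{v\notin T: d(v)\text{ even}\}$. $(\mathcal{P})$: $|E(G)|+|T|$ even. $(\mathcal{S})$: $Source(T)\neq\emptyset$ and if $|Source(T)|=1$ then $|V(G)|=1$ or $Source(T)\neq Sink(T)$. $(\overline{\mathcal{S}})$: $Sink(T)\neq\emptyset$ and if $|Sink(T)|=1$ then $|V(G)|=1$ or $Sink(T)\neq Source(T)$. -}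

module Defs where

open import Data.Nat using (ℕ; zero; suc; _+_; _*_; _%_; _≡ᵇ_; _<ᵇ_)
open import Data.Bool using (Bool; true; false; _∧_; _∨_; not; if_then_else_)
open import Data.Fin using (Fin; toℕ)
open import Data.Product using (_×_; _,_)
open import Data.Sum using (_⊎_)
open import Data.List using (List; []; _∷_; cartesianProduct; allFin)
open import Relation.Binary.PropositionalEquality using (_≡_)
open import Relation.Binary.Construct.Closure.Transitive using (TransClosure)
open import Relation.Nullary using (¬_)

-- Vertices of C_p □ P_q : pairs (i , j), i ∈ Z_p (cycle coordinate), j ∈ {0..q-1} (path coordinate)
V : ℕ → ℕ → Set
V p q = Fin p × Fin q

vertices : (p q : ℕ) → List (V p q)
vertices p q = cartesianProduct (allFin p) (allFin q)

count : {A : Set} → (A → Bool) → List A → ℕ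
count f [] = 0
count f (x ∷ xs) = (if f x then 1 else 0) + count f xs

cycAdj : ℕ → ℕ → ℕ → Bool
cycAdj zero a b = false
cycAdj (suc n) a b = ((suc a % suc n) ≡ᵇ b) ∨ ((suc b % suc n) ≡ᵇ a)

pathAdj : ℕ → ℕ → Bool
pathAdj a b = (suc a ≡ᵇ b) ∨ (suc b ≡ᵇ a)

adj : (p q : ℕ) → V p q → V p q → Bool
adj p q (i , j) (i' , j') =
  ((toℕ j ≡ᵇ toℕ j') ∧ cycAdj p (toℕ i) (toℕ i'))
  ∨ ((toℕ i ≡ᵇ toℕ i') ∧ pathAdj (toℕ j) (toℕ j'))

deg : (p q : ℕ) → V p q → ℕ
deg p q v = count (λ u → adj p q u v) (vertices p q)

-- an injective numbering of vertices, used to count each edge once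
key : (p q : ℕ) → V p q → ℕ
key p q (i , j) = toℕ j * p + toℕ i

numEdges : (p q : ℕ) → ℕ
numEdges p q = count (λ e → adj p q (Data.Product.proj₁ e) (Data.Product.proj₂ e)
                            ∧ (key p q (Data.Product.proj₁ e) <ᵇ key p q (Data.Product.proj₂ e)))
                     (cartesianProduct (vertices p q) (vertices p q))
  where import Data.Product

Subset : ℕ → ℕ → Set
Subset p q = V p q → Bool

card : (p q : ℕ) → (V p q → Bool) → ℕ
card p q S = count S (vertices p q)

odd : ℕ → Bool
odd n = n % 2 ≡ᵇ 1

-- O u v ≡ true means the edge uv is oriented from u to v
IsOrientation : (p q : ℕ) → (V p q → V p q → Bool) → Set
IsOrientation p q O =
  (∀ u v → O u v ≡ true → adj p q u v ≡ true) ×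
  (∀ u v → adj p q u v ≡ true →
     (O u v ≡ true × O v u ≡ false) ⊎ (O u v ≡ false × O v u ≡ true))

indeg : (p q : ℕ) → (V p q → V p q → Bool) → V p q → ℕ
indeg p q O v = count (λ u → O u v) (vertices p q)

IsTOdd : (p q : ℕ) → Subset p q → (V p q → V p q → Bool) → Set
IsTOdd p q T O = ∀ v → (odd (indeg p q O v) ≡ true → T v ≡ true)
                     × (T v ≡ true → odd (indeg p q O v) ≡ true)

Arc : (p q : ℕ) → (V p q → V p q → Bool) → V p q → V p q → Set
Arc p q O u v = O u v ≡ true

IsAcyclic : (p q : ℕ) → (V p q → V p q → Bool) → Set
IsAcyclic p q O = ∀ v → ¬ TransClosure (Arc p q O) v v

Source : (p q : ℕ) → Subset p q → V p q → Bool
Source p q T v = not (T v)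

Sink : (p q : ℕ) → Subset p q → V p q → Bool
Sink p q T v = (T v ∧ odd (deg p q v)) ∨ (not (T v) ∧ not (odd (deg p q v)))

CondP : (p q : ℕ) → Subset p q → Set
CondP p q T = (numEdges p q + card p q T) % 2 ≡ 0

SameSet : (p q : ℕ) → (V p q → Bool) → (V p q → Bool) → Set
SameSet p q A B = ∀ v → A v ≡ B v

CondS : (p q : ℕ) → Subset p q → Set
CondS p q T = ¬ (card p q (Source p q T) ≡ 0) ×
  (card p q (Source p q T) ≡ 1 → (p * q ≡ 1) ⊎ ¬ SameSet p q (Source p q T) (Sink p q T))

CondSbar : (p q : ℕ) → Subset p q → Set
CondSbar p q T = ¬ (card p q (Sink p q T) ≡ 0) ×
  (card p q (Sink p q T) ≡ 1 → (p * q ≡ 1) ⊎ ¬ SameSet p q (Sink p q T) (Source p q T))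

-- An acyclic orientation is the same as a ranking of the vertices, every edge pointing towards the
-- larger rank; a vertex then has odd in-degree when an odd number of its neighbours rank below it.
-- On the even cycle C_p, a target T with |T| even and a vertex a ∉ T is realised by ranking the
-- positions k = 1, …, p - 1 counted from a as p - k or p + k, as the prefix parities of T dictate.
-- On C_p □ P_q the rows are added one at a time: the new top row gets such a cycle ranking, each of
-- its vertices being put below or above all earlier vertices. This choice orients the vertical edges
-- and so changes the target of the row beneath by a known set; the parity of the top row determines
-- a choice that keeps the remaining target admissible (even, with a source and a sink). The few
-- targets for which no choice works are realised after reversing the path, or by an explicit
-- ranking of three rows.

module Submission where

open import Defs
open import Data.Nat using (ℕ; zero; suc; z<s; s<s; _+_; _*_; _∸_; _%_; _≡ᵇ_; _<ᵇ_; _≤_; _<_; _<?_; _≤?_; z≤n; s≤s)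
open import Data.Nat.Properties
open import Data.Nat.DivMod using ([m+n]%n≡m%n; n%n≡0; m%n<n; m<n⇒m%n≡m; %-distribˡ-+; m%n%n≡m%n)
open import Data.Bool using (Bool; true; false; not; _∧_; _∨_; _xor_; if_then_else_) renaming (T to IsTrue)
open import Data.Bool.Properties
  using (xor-∧-commutativeRing; xor-assoc; xor-comm; xor-identityʳ; xor-same; xor-annihilates-not;
         not-involutive; not-injective; not-distribˡ-xor; not-distribʳ-xor; T-≡;
         ∧-identityʳ; ∧-zeroʳ; ∧-assoc; ∧-distribʳ-xor; ∨-comm; ∨-zeroʳ)
open import Data.Fin using (Fin; toℕ) renaming (zero to fzero; suc to fsuc)
open import Data.Fin.Properties using (toℕ<n)
open import Data.List using (List; []; _∷_; _++_; map; cartesianProduct; allFin; tabulate)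
open import Data.Maybe using (Maybe; just; nothing; maybe)
import Data.Maybe as Maybe
open import Data.Product using (Σ; ∃; _×_; _,_; proj₁; proj₂)
open import Data.Sum using (_⊎_; inj₁; inj₂)
open import Data.Empty using (⊥-elim)
open import Data.Unit using (⊤; tt)
open import Function.Bundles using (Equivalence)
open import Function.Base using (case_of_)
open import Relation.Nullary using (¬_; yes; no)
open import Relation.Nullary.Decidable using (True; toWitness)
open import Relation.Binary.PropositionalEquality
open import Relation.Binary.Definitions using (tri<; tri≈; tri>)
open import Relation.Binary.Construct.Closure.Transitive using (TransClosure; [_]; _∷_)
open import Algebra.Bundles using (CommutativeRing)
open import Algebra.Properties.CommutativeSemigroup (CommutativeRing.+-commutativeSemigroup xor-∧-commutativeRing)
  using () renaming (interchange to xor-interchange)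

true≢false : true ≢ false
true≢false ()

≢not : ∀ b → b ≢ not b
≢not false ()
≢not true ()

xor-trueʳ : ∀ b → b xor true ≡ not b
xor-trueʳ b = xor-comm b true

xor-cancelʳ : ∀ a b → (a xor b) xor b ≡ a
xor-cancelʳ a b = trans (xor-assoc a b b) (trans (cong (a xor_) (xor-same b)) (xor-identityʳ a))

xor≡false⇒≡ : ∀ {a b} → a xor b ≡ false → a ≡ b
xor≡false⇒≡ {false} {false} _ = refl
xor≡false⇒≡ {true} {true} _ = refl

∨≡true : ∀ {a b} → a ∨ b ≡ true → a ≡ true ⊎ b ≡ true
∨≡true {true} _ = inj₁ refl
∨≡true {false} b≡true = inj₂ b≡true

∧≡true : ∀ {a b} → a ∧ b ≡ true → a ≡ true × b ≡ true
∧≡true {true} {true} _ = refl , refl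

∨-∧-disjoint : ∀ x y z → x ∧ y ≡ false → (x ∨ y) ∧ z ≡ (x ∧ z) xor (y ∧ z)
∨-∧-disjoint false y z _ = refl
∨-∧-disjoint true false z _ = sym (xor-identityʳ z)

if-true : {A : Set} {b : Bool} {x y : A} → b ≡ true → (if b then x else y) ≡ x
if-true refl = refl

if-false : {A : Set} {b : Bool} {x y : A} → b ≡ false → (if b then x else y) ≡ y
if-false refl = refl

if-id : ∀ b → (if b then true else false) ≡ b
if-id false = refl
if-id true = refl

parity : ℕ → Bool
parity zero = false
parity (suc n) = not (parity n)

odd≡parity : ∀ n → odd n ≡ parity n
odd≡parity zero = refl
odd≡parity (suc zero) = refl
odd≡parity (suc (suc n)) = begin
    (suc (suc n) % 2 ≡ᵇ 1)  ≡⟨ cong (λ k → k % 2 ≡ᵇ 1) (+-comm 2 n) ⟩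
    ((n + 2) % 2 ≡ᵇ 1)      ≡⟨ cong (_≡ᵇ 1) ([m+n]%n≡m%n n 2) ⟩
    (n % 2 ≡ᵇ 1)            ≡⟨ odd≡parity n ⟩
    parity n                ≡⟨ not-involutive (parity n) ⟨
    not (not (parity n))    ∎
  where open ≡-Reasoning

parity-+ : ∀ m n → parity (m + n) ≡ parity m xor parity n
parity-+ zero n = refl
parity-+ (suc m) n = trans (cong not (parity-+ m n)) (not-distribˡ-xor (parity m) (parity n))

xorList : {A : Set} → (A → Bool) → List A → Bool
xorList f [] = false
xorList f (x ∷ xs) = f x xor xorList f xs

parity-count : {A : Set} (f : A → Bool) (xs : List A) → parity (count f xs) ≡ xorList f xs
parity-count f [] = refl
parity-count f (x ∷ xs) with f x
... | true = cong not (parity-count f xs)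
... | false = parity-count f xs

xorList-cong : {A : Set} {f g : A → Bool} (xs : List A) → (∀ x → f x ≡ g x) → xorList f xs ≡ xorList g xs
xorList-cong [] f≡g = refl
xorList-cong (x ∷ xs) f≡g = cong₂ _xor_ (f≡g x) (xorList-cong xs f≡g)

xorList-++ : {A : Set} (f : A → Bool) (xs ys : List A) → xorList f (xs ++ ys) ≡ xorList f xs xor xorList f ys
xorList-++ f [] ys = refl
xorList-++ f (x ∷ xs) ys =
  trans (cong (f x xor_) (xorList-++ f xs ys)) (sym (xor-assoc (f x) (xorList f xs) (xorList f ys)))

xorList-map : {A B : Set} (f : B → Bool) (g : A → B) (xs : List A) → xorList f (map g xs) ≡ xorList (λ x → f (g x)) xs
xorList-map f g [] = refl
xorList-map f g (x ∷ xs) = cong (f (g x) xor_) (xorList-map f g xs)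

xorList-cartesianProduct : {A B : Set} (f : A × B → Bool) (xs : List A) (ys : List B) →
  xorList f (cartesianProduct xs ys) ≡ xorList (λ x → xorList (λ y → f (x , y)) ys) xs
xorList-cartesianProduct f [] ys = refl
xorList-cartesianProduct f (x ∷ xs) ys =
  trans (xorList-++ f (map (x ,_) ys) (cartesianProduct xs ys))
        (cong₂ _xor_ (xorList-map f (x ,_) ys) (xorList-cartesianProduct f xs ys))

count-nonzero : {A : Set} (f : A → Bool) (xs : List A) → count f xs ≢ 0 → ∃ λ x → f x ≡ true
count-nonzero f [] count≢0 = ⊥-elim (count≢0 refl)
count-nonzero f (x ∷ xs) count≢0 with f x in fx
... | true = x , fx
... | false = count-nonzero f xs count≢0

xorSum : (ℕ → Bool) → ℕ → Bool
xorSum f zero = false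
xorSum f (suc n) = f 0 xor xorSum (λ k → f (suc k)) n

xorList-tabulate : {A : Set} {F : A → Bool} {f : ℕ → Bool} (n : ℕ) (g : Fin n → A) →
  (∀ x → F (g x) ≡ f (toℕ x)) → xorList F (tabulate g) ≡ xorSum f n
xorList-tabulate zero g Fg≡f = refl
xorList-tabulate (suc n) g Fg≡f = cong₂ _xor_ (Fg≡f fzero) (xorList-tabulate n (λ x → g (fsuc x)) (λ x → Fg≡f (fsuc x)))

xorList-allFin : (n : ℕ) (f : ℕ → Bool) → xorList (λ x → f (toℕ x)) (allFin n) ≡ xorSum f n
xorList-allFin n f = xorList-tabulate n (λ x → x) (λ x → refl)

xorSum-cong : ∀ n {f g : ℕ → Bool} → (∀ k → k < n → f k ≡ g k) → xorSum f n ≡ xorSum g n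
xorSum-cong zero f≡g = refl
xorSum-cong (suc n) f≡g = cong₂ _xor_ (f≡g 0 z<s) (xorSum-cong n (λ k k<n → f≡g (suc k) (s<s k<n)))

xorSum-snoc : ∀ n (f : ℕ → Bool) → xorSum f (suc n) ≡ xorSum f n xor f n
xorSum-snoc zero f = xor-comm (f 0) false
xorSum-snoc (suc n) f =
  trans (cong (f 0 xor_) (xorSum-snoc n (λ k → f (suc k)))) (sym (xor-assoc (f 0) _ _))

xorSum-xor : ∀ n (f g : ℕ → Bool) → xorSum (λ k → f k xor g k) n ≡ xorSum f n xor xorSum g n
xorSum-xor zero f g = refl
xorSum-xor (suc n) f g =
  trans (cong ((f 0 xor g 0) xor_) (xorSum-xor n (λ k → f (suc k)) (λ k → g (suc k))))
        (xor-interchange (f 0) (g 0) _ _)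

xorSum-false : ∀ n → xorSum (λ _ → false) n ≡ false
xorSum-false zero = refl
xorSum-false (suc n) = xorSum-false n

xorSum-allFalse : ∀ n {f : ℕ → Bool} → (∀ k → k < n → f k ≡ false) → xorSum f n ≡ false
xorSum-allFalse n f≡false = trans (xorSum-cong n f≡false) (xorSum-false n)

xorSum-const : ∀ n b → xorSum (λ _ → b) n ≡ b ∧ parity n
xorSum-const zero false = refl
xorSum-const zero true = refl
xorSum-const (suc n) false = xorSum-false n
xorSum-const (suc n) true = cong not (xorSum-const n true)

xorSum-∧ʳ : ∀ n (f : ℕ → Bool) c → xorSum (λ k → f k ∧ c) n ≡ xorSum f n ∧ c
xorSum-∧ʳ zero f c = refl
xorSum-∧ʳ (suc n) f c =
  trans (cong ((f 0 ∧ c) xor_) (xorSum-∧ʳ n (λ k → f (suc k)) c))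
        (sym (∧-distribʳ-xor c (f 0) (xorSum (λ k → f (suc k)) n)))

xorSum-not : ∀ n (f : ℕ → Bool) → xorSum (λ k → not (f k)) n ≡ xorSum f n xor parity n
xorSum-not zero f = refl
xorSum-not (suc n) f =
  trans (cong (not (f 0) xor_) (xorSum-not n (λ k → f (suc k))))
        (not-xor-xor (f 0) (xorSum (λ k → f (suc k)) n) (parity n))
  where
    not-xor-xor : ∀ a b c → not a xor (b xor c) ≡ (a xor b) xor not c
    not-xor-xor false b c = not-distribʳ-xor b c
    not-xor-xor true b c = sym (xor-annihilates-not b c)

xorSum-point : ∀ n a (h : ℕ → Bool) → a < n → xorSum (λ k → (k ≡ᵇ a) ∧ h k) n ≡ h a
xorSum-point (suc n) zero h _ = trans (cong (h 0 xor_) (xorSum-false n)) (xor-identityʳ (h 0))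
xorSum-point (suc n) (suc a) h (s≤s a<n) = xorSum-point n a (λ k → h (suc k)) a<n

xorSum-beyond : ∀ n a (h : ℕ → Bool) → n ≤ a → xorSum (λ k → (k ≡ᵇ a) ∧ h k) n ≡ false
xorSum-beyond zero a h _ = refl
xorSum-beyond (suc n) (suc a) h (s≤s n≤a) = xorSum-beyond n a (λ k → h (suc k)) n≤a

xorSum-indicator : ∀ n a → a < n → xorSum (λ k → k ≡ᵇ a) n ≡ true
xorSum-indicator n a a<n =
  trans (sym (xorSum-cong n (λ k _ → ∧-identityʳ (k ≡ᵇ a)))) (xorSum-point n a (λ _ → true) a<n)

<ᵇ-true : ∀ {m n} → m < n → (m <ᵇ n) ≡ true
<ᵇ-true m<n = Equivalence.to T-≡ (<⇒<ᵇ m<n)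

<ᵇ-sound : ∀ {m n} → (m <ᵇ n) ≡ true → m < n
<ᵇ-sound {m} {n} eq = <ᵇ⇒< m n (Equivalence.from T-≡ eq)

<ᵇ-false : ∀ {m n} → n ≤ m → (m <ᵇ n) ≡ false
<ᵇ-false {m} {n} n≤m with m <ᵇ n in eq
... | false = refl
... | true = ⊥-elim (<⇒≱ (<ᵇ-sound eq) n≤m)

<ᵇ-irrefl : ∀ n → (n <ᵇ n) ≡ false
<ᵇ-irrefl n = <ᵇ-false (≤-refl {n})

<ᵇ-flip : ∀ {m n} → m ≢ n → (n <ᵇ m) ≡ not (m <ᵇ n)
<ᵇ-flip {m} {n} m≢n with <-cmp m n
... | tri< m<n _ _ = trans (<ᵇ-false (<⇒≤ m<n)) (sym (cong not (<ᵇ-true m<n)))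
... | tri≈ _ m≡n _ = ⊥-elim (m≢n m≡n)
... | tri> _ _ n<m = trans (<ᵇ-true n<m) (sym (cong not (<ᵇ-false (<⇒≤ n<m))))

<ᵇ-antisym : ∀ {m n} → (m <ᵇ n) ≡ false → (n <ᵇ m) ≡ false → m ≡ n
<ᵇ-antisym {m} {n} m≮n n≮m with <-cmp m n
... | tri< m<n _ _ = ⊥-elim (true≢false (trans (sym (<ᵇ-true m<n)) m≮n))
... | tri≈ _ m≡n _ = m≡n
... | tri> _ _ n<m = ⊥-elim (true≢false (trans (sym (<ᵇ-true n<m)) n≮m))

<ᵇ-+ˡ : ∀ k m n → (k + m <ᵇ k + n) ≡ (m <ᵇ n)
<ᵇ-+ˡ zero m n = refl
<ᵇ-+ˡ (suc k) m n = <ᵇ-+ˡ k m n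

<ᵇ-∸ˡ : ∀ k m n → m ≤ k → n ≤ k → (k ∸ m <ᵇ k ∸ n) ≡ (n <ᵇ m)
<ᵇ-∸ˡ k m n m≤k n≤k with <-cmp n m
... | tri< n<m _ _ = trans (<ᵇ-true (∸-monoʳ-< n<m m≤k)) (sym (<ᵇ-true n<m))
... | tri≈ _ refl _ = trans (<ᵇ-irrefl (k ∸ m)) (sym (<ᵇ-irrefl m))
... | tri> _ _ m<n = trans (<ᵇ-false (∸-monoʳ-≤ k (<⇒≤ m<n))) (sym (<ᵇ-false (<⇒≤ m<n)))

≡ᵇ-sound : ∀ {m n} → (m ≡ᵇ n) ≡ true → m ≡ n
≡ᵇ-sound {m} {n} eq = ≡ᵇ⇒≡ m n (Equivalence.from T-≡ eq)

≡ᵇ-refl : ∀ n → (n ≡ᵇ n) ≡ true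
≡ᵇ-refl n = Equivalence.to T-≡ (≡⇒≡ᵇ n n refl)

≡ᵇ-false : ∀ {m n} → m ≢ n → (m ≡ᵇ n) ≡ false
≡ᵇ-false {zero} {zero} m≢n = ⊥-elim (m≢n refl)
≡ᵇ-false {zero} {suc n} m≢n = refl
≡ᵇ-false {suc m} {zero} m≢n = refl
≡ᵇ-false {suc m} {suc n} m≢n = ≡ᵇ-false (λ m≡n → m≢n (cong suc m≡n))

≡ᵇ-false⇒≢ : ∀ {m n} → (m ≡ᵇ n) ≡ false → m ≢ n
≡ᵇ-false⇒≢ {m} eq refl with () ← trans (sym (≡ᵇ-refl m)) eq

≡ᵇ-comm : ∀ m n → (m ≡ᵇ n) ≡ (n ≡ᵇ m)
≡ᵇ-comm zero zero = refl
≡ᵇ-comm zero (suc n) = refl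
≡ᵇ-comm (suc m) zero = refl
≡ᵇ-comm (suc m) (suc n) = ≡ᵇ-comm m n

decide< : ∀ {m n} {m<n : True (m <? n)} → m < n
decide< {m<n = m<n} = toWitness m<n

decide≤ : ∀ {m n} {m≤n : True (m ≤? n)} → m ≤ n
decide≤ {m≤n = m≤n} = toWitness m≤n

<2+-cases : ∀ {j m} → j < suc (suc m) → j < m ⊎ j ≡ m ⊎ j ≡ suc m
<2+-cases (s≤s j≤m+1) with m≤n⇒m<n∨m≡n j≤m+1
... | inj₂ j≡m+1 = inj₂ (inj₂ j≡m+1)
... | inj₁ (s≤s j≤m) with m≤n⇒m<n∨m≡n j≤m
...   | inj₁ j<m = inj₁ j<m
...   | inj₂ j≡m = inj₂ (inj₁ j≡m)

avoid2 : ∀ a b → ∃ λ c → c < 3 × c ≢ a × c ≢ b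
avoid2 a b with 0 ≟ a | 0 ≟ b | 1 ≟ a | 1 ≟ b
... | no 0≢a | no 0≢b | _ | _ = 0 , decide< , 0≢a , 0≢b
... | yes refl | _ | _ | no 1≢b = 1 , decide< , (λ ()) , 1≢b
... | _ | yes refl | no 1≢a | _ = 1 , decide< , 1≢a , (λ ())
... | yes refl | _ | _ | yes refl = 2 , decide< , (λ ()) , (λ ())
... | _ | yes refl | yes refl | _ = 2 , decide< , (λ ()) , (λ ())

search : (f : ℕ → Bool) (k : ℕ) → (∀ i → i < k → f i ≡ false) ⊎ ∃ λ i → i < k × f i ≡ true
search f zero = inj₁ (λ i ())
search f (suc k) with search f k | f k in fk
... | inj₂ (i , i<k , fi) | _ = inj₂ (i , <-trans i<k (n<1+n k) , fi)
... | inj₁ _ | true = inj₂ (k , n<1+n k , fk)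
... | inj₁ below-k | false = inj₁ λ i i<k+1 → case m≤n⇒m<n∨m≡n (≤-pred i<k+1) of λ
  { (inj₁ i<k) → below-k i i<k
  ; (inj₂ refl) → fk }

data Comparison (x y : ℕ) : Bool → Set where
  lower : x < y → Comparison x y true
  higher : y < x → Comparison x y false

Comparison-<ᵇ : ∀ {x y b} → Comparison x y b → (x <ᵇ y) ≡ b
Comparison-<ᵇ (lower x<y) = <ᵇ-true x<y
Comparison-<ᵇ (higher y<x) = <ᵇ-false (<⇒≤ y<x)

Comparison-flip : ∀ {x y b} → Comparison x y b → Comparison y x (not b)
Comparison-flip (lower x<y) = higher x<y
Comparison-flip (higher y<x) = lower y<x

Comparison-≢ : ∀ {x y b} → Comparison x y b → x ≢ y
Comparison-≢ (lower x<y) = <⇒≢ x<y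
Comparison-≢ (higher y<x) x≡y = <⇒≢ y<x (sym x≡y)

-- The cycle C_p, p = n + 4 even

module Cycle (n : ℕ) (n-even : parity n ≡ false) where

  p-1 : ℕ
  p-1 = suc (suc (suc n))

  p : ℕ
  p = suc p-1

  p-2 : ℕ
  p-2 = suc (suc n)

  p-1-odd : parity p-1 ≡ true
  p-1-odd = cong (λ b → not (not (not b))) n-even

  p-even : parity p ≡ false
  p-even = cong not p-1-odd

  3<p : 3 < p
  3<p = s≤s (s≤s (s≤s (s≤s z≤n)))

  xorSum-not-p : ∀ (f : ℕ → Bool) → xorSum (λ i → not (f i)) p ≡ xorSum f p
  xorSum-not-p f = trans (xorSum-not p f) (trans (cong (xorSum f p xor_) p-even) (xor-identityʳ _))

  xorSum-const-p : ∀ b → xorSum (λ _ → b) p ≡ false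
  xorSum-const-p b = trans (xorSum-const p b) (trans (cong (b ∧_) p-even) (∧-zeroʳ b))

  next : ℕ → ℕ
  next i = suc i % p

  prev : ℕ → ℕ
  prev zero = p-1
  prev (suc i) = i

  next-suc : ∀ i → suc i < p → next i ≡ suc i
  next-suc i = m<n⇒m%n≡m

  next-last : next p-1 ≡ 0
  next-last = n%n≡0 p

  next<p : ∀ i → next i < p
  next<p i = m%n<n (suc i) p

  prev<p : ∀ i → i < p → prev i < p
  prev<p zero _ = ≤-refl
  prev<p (suc i) i<p = <-trans (n<1+n i) i<p

  <p-split : ∀ {i} → i < p → suc i < p ⊎ i ≡ p-1
  <p-split (s≤s i≤p-1) with m≤n⇒m<n∨m≡n i≤p-1
  ... | inj₁ i<p-1 = inj₁ (s≤s i<p-1)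
  ... | inj₂ i≡p-1 = inj₂ i≡p-1

  next-prev : ∀ i → i < p → next (prev i) ≡ i
  next-prev zero _ = next-last
  next-prev (suc i) i<p = next-suc i i<p

  prev-next : ∀ i → i < p → prev (next i) ≡ i
  prev-next i i<p with <p-split i<p
  ... | inj₁ si<p = cong prev (next-suc i si<p)
  ... | inj₂ refl = cong prev next-last

  next≢ : ∀ i → i < p → next i ≢ i
  next≢ i i<p with <p-split i<p
  ... | inj₁ si<p = λ eq → 1+n≢n (trans (sym (next-suc i si<p)) eq)
  ... | inj₂ refl = λ eq → 1+n≢0 (sym (trans (sym next-last) eq))

  prev≢next : ∀ i → i < p → prev i ≢ next i
  prev≢next zero _ eq = 1+n≢0 (suc-injective eq)
  prev≢next (suc i) i<p with <p-split i<p
  ... | inj₁ si<p = λ eq → <⇒≢ (<-trans (n<1+n i) (n<1+n (suc i))) (trans eq (next-suc (suc i) si<p))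
  ... | inj₂ refl = λ eq → 1+n≢0 (trans eq next-last)

  [m%p+n]%p≡[m+n]%p : ∀ m n → (m % p + n) % p ≡ (m + n) % p
  [m%p+n]%p≡[m+n]%p m n = begin
      (m % p + n) % p          ≡⟨ %-distribˡ-+ (m % p) n p ⟩
      (m % p % p + n % p) % p  ≡⟨ cong (λ k → (k + n % p) % p) (m%n%n≡m%n m p) ⟩
      (m % p + n % p) % p      ≡⟨ %-distribˡ-+ m n p ⟨
      (m + n) % p              ∎
    where open ≡-Reasoning

  [m+n%p]%p≡[m+n]%p : ∀ m n → (m + n % p) % p ≡ (m + n) % p
  [m+n%p]%p≡[m+n]%p m n =
    trans (cong (_% p) (+-comm m (n % p))) (trans ([m%p+n]%p≡[m+n]%p n m) (cong (_% p) (+-comm n m)))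

  cycleIn : (ℕ → ℕ) → ℕ → Bool
  cycleIn s i = (s (prev i) <ᵇ s i) xor (s (next i) <ᵇ s i)

  record CycleRanking (c : ℕ → Bool) : Set where
    field
      rank : ℕ → ℕ
      bound : ℕ
      rank<bound : ∀ i → rank i < bound
      rank-next≢ : ∀ i → i < p → rank (next i) ≢ rank i
      cycleIn≡ : ∀ i → i < p → cycleIn rank i ≡ c i

  -- Position k > 0 gets height p + k or p ∸ k, so consecutive positions compare as `rising` says;
  -- `rising` comes from the prefix parities of c so that every in-degree has the parity c asks for,
  -- and c 0 = false lets position 0 be the minimum.
  module RankingFromZero (c : ℕ → Bool) (c0 : c 0 ≡ false) (c-sum : xorSum c p ≡ false) where

    prefix : ℕ → Bool
    prefix zero = false
    prefix (suc k) = prefix k xor c k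

    rising : ℕ → Bool
    rising k = prefix k xor parity k

    height : ℕ → ℕ
    height zero = 0
    height (suc k) = if rising (suc k) then p + suc k else p ∸ suc k

    p∸≤height : ∀ k → p ∸ suc k ≤ height (suc k)
    p∸≤height k with rising (suc k)
    ... | true = ≤-trans (m∸n≤m p (suc k)) (m≤m+n p (suc k))
    ... | false = ≤-refl

    height≤p+ : ∀ k → height (suc k) ≤ p + suc k
    height≤p+ k with rising (suc k)
    ... | true = ≤-refl
    ... | false = ≤-trans (m∸n≤m p (suc k)) (m≤m+n p (suc k))

    0<height : ∀ k → suc k < p → 0 < height (suc k)
    0<height k k+1<p = <-≤-trans (m<n⇒0<n∸m k+1<p) (p∸≤height k)

    height<2p : ∀ k → k < p → height k < p + p
    height<2p zero _ = s≤s z≤n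
    height<2p (suc k) k+1<p = ≤-<-trans (height≤p+ k) (+-monoʳ-< p k+1<p)

    height-step : ∀ k → suc (suc k) < p →
      Comparison (height (suc k)) (height (suc (suc k))) (rising (suc (suc k)))
    height-step k k+2<p with rising (suc (suc k))
    ... | true = lower (≤-<-trans (height≤p+ k) (+-monoʳ-< p (n<1+n (suc k))))
    ... | false = higher (<-≤-trans (∸-monoʳ-< (n<1+n (suc k)) (<⇒≤ k+2<p)) (p∸≤height k))

    prefix≡xorSum : ∀ k → prefix k ≡ xorSum c k
    prefix≡xorSum zero = refl
    prefix≡xorSum (suc k) = trans (cong (_xor c k) (prefix≡xorSum k)) (sym (xorSum-snoc k c))

    rising-step : ∀ x π b → (x xor π) xor not ((x xor b) xor not π) ≡ b
    rising-step false false false = refl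
    rising-step false false true = refl
    rising-step false true false = refl
    rising-step false true true = refl
    rising-step true false false = refl
    rising-step true false true = refl
    rising-step true true false = refl
    rising-step true true true = refl

    cycleIn-height-inner : ∀ k → suc (suc (suc k)) < p → cycleIn height (suc (suc k)) ≡ c (suc (suc k))
    cycleIn-height-inner k k+3<p = begin
        (height (suc k) <ᵇ height (suc (suc k))) xor (height (next (suc (suc k))) <ᵇ height (suc (suc k)))
          ≡⟨ cong (λ i → (height (suc k) <ᵇ height (suc (suc k))) xor (height i <ᵇ height (suc (suc k))))
                  (next-suc (suc (suc k)) k+3<p) ⟩
        (height (suc k) <ᵇ height (suc (suc k))) xor (height (suc (suc (suc k))) <ᵇ height (suc (suc k)))
          ≡⟨ cong₂ _xor_ (Comparison-<ᵇ (height-step k (<-trans (n<1+n (suc (suc k))) k+3<p)))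
                         (Comparison-<ᵇ (Comparison-flip (height-step (suc k) k+3<p))) ⟩
        rising (suc (suc k)) xor not (rising (suc (suc (suc k))))
          ≡⟨ rising-step (prefix (suc (suc k))) (parity (suc (suc k))) (c (suc (suc k))) ⟩
        c (suc (suc k))  ∎
      where open ≡-Reasoning

    cycleIn-height-last : cycleIn height p-1 ≡ c p-1
    cycleIn-height-last = begin
        (height (suc (suc n)) <ᵇ height p-1) xor (height (next p-1) <ᵇ height p-1)
          ≡⟨ cong (λ i → (height (suc (suc n)) <ᵇ height p-1) xor (height i <ᵇ height p-1)) next-last ⟩
        (height (suc (suc n)) <ᵇ height p-1) xor (0 <ᵇ height p-1)
          ≡⟨ cong₂ _xor_ (Comparison-<ᵇ (height-step (suc n) ≤-refl)) (<ᵇ-true (0<height (suc (suc n)) ≤-refl)) ⟩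
        (prefix p-1 xor parity p-1) xor true
          ≡⟨ cong₂ (λ x π → (x xor π) xor true) last-prefix p-1-odd ⟩
        (c p-1 xor true) xor true  ≡⟨ xor-cancelʳ (c p-1) true ⟩
        c p-1                      ∎
      where
        open ≡-Reasoning
        last-prefix : prefix p-1 ≡ c p-1
        last-prefix = xor≡false⇒≡ (trans (prefix≡xorSum p) c-sum)

    cycleIn-height : ∀ k → k < p → cycleIn height k ≡ c k
    cycleIn-height zero _ = sym c0
    cycleIn-height (suc zero) _ = begin
        (0 <ᵇ height 1) xor (height 2 <ᵇ height 1)
          ≡⟨ cong₂ _xor_ (<ᵇ-true (0<height 0 (s≤s (s≤s z≤n))))
                         (Comparison-<ᵇ (Comparison-flip (height-step 0 (s≤s (s≤s (s≤s z≤n)))))) ⟩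
        not (not ((c 0 xor c 1) xor false))  ≡⟨ not-involutive _ ⟩
        (c 0 xor c 1) xor false              ≡⟨ xor-identityʳ _ ⟩
        c 0 xor c 1                          ≡⟨ cong (_xor c 1) c0 ⟩
        c 1                                  ∎
      where open ≡-Reasoning
    cycleIn-height (suc (suc k)) k+2<p with <p-split k+2<p
    ... | inj₁ k+3<p = cycleIn-height-inner k k+3<p
    ... | inj₂ refl = cycleIn-height-last

    height-next≢ : ∀ k → k < p → height (next k) ≢ height k
    height-next≢ zero _ eq = <⇒≢ (0<height 0 (s≤s (s≤s z≤n))) (sym eq)
    height-next≢ (suc k) k+1<p with <p-split k+1<p
    ... | inj₁ k+2<p = λ eq →
      Comparison-≢ (height-step k k+2<p) (sym (trans (sym (cong height (next-suc (suc k) k+2<p))) eq))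
    ... | inj₂ refl = λ eq → <⇒≢ (0<height (suc (suc n)) ≤-refl) (trans (sym (cong height next-last)) eq)

  offset : ℕ → ℕ → ℕ
  offset a i = (i + (p ∸ a)) % p

  shift : ℕ → ℕ → ℕ
  shift a k = (k + a) % p

  offset<p : ∀ a i → offset a i < p
  offset<p a i = m%n<n (i + (p ∸ a)) p

  offset-next : ∀ a i → offset a (next i) ≡ next (offset a i)
  offset-next a i = trans ([m%p+n]%p≡[m+n]%p (suc i) (p ∸ a)) (sym ([m+n%p]%p≡[m+n]%p 1 (i + (p ∸ a))))

  offset-prev : ∀ a i → i < p → offset a (prev i) ≡ prev (offset a i)
  offset-prev a i i<p = sym (begin
      prev (offset a i)               ≡⟨ cong (λ k → prev (offset a k)) (next-prev i i<p) ⟨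
      prev (offset a (next (prev i))) ≡⟨ cong prev (offset-next a (prev i)) ⟩
      prev (next (offset a (prev i))) ≡⟨ prev-next (offset a (prev i)) (offset<p a (prev i)) ⟩
      offset a (prev i)               ∎)
    where open ≡-Reasoning

  shift-offset : ∀ a i → a < p → i < p → shift a (offset a i) ≡ i
  shift-offset a i a<p i<p = begin
      ((i + (p ∸ a)) % p + a) % p  ≡⟨ [m%p+n]%p≡[m+n]%p (i + (p ∸ a)) a ⟩
      (i + (p ∸ a) + a) % p        ≡⟨ cong (_% p) (+-assoc i (p ∸ a) a) ⟩
      (i + (p ∸ a + a)) % p        ≡⟨ cong (λ k → (i + k) % p) (m∸n+n≡m (<⇒≤ a<p)) ⟩
      (i + p) % p                  ≡⟨ [m+n]%n≡m%n i p ⟩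
      i % p                        ≡⟨ m<n⇒m%n≡m i<p ⟩
      i                            ∎
    where open ≡-Reasoning

  offset-self : ∀ a → a < p → offset a a ≡ 0
  offset-self a a<p = trans (cong (_% p) (m+[n∸m]≡n (<⇒≤ a<p))) (n%n≡0 p)

  offset≡0⇒≡ : ∀ a i → a < p → i < p → offset a i ≡ 0 → i ≡ a
  offset≡0⇒≡ a i a<p i<p eq = trans (sym (shift-offset a i a<p i<p)) (trans (cong (shift a) eq) (m<n⇒m%n≡m a<p))

  xorSum-next : ∀ (f : ℕ → Bool) → xorSum (λ k → f (next k)) p ≡ xorSum f p
  xorSum-next f = begin
      xorSum (λ k → f (next k)) p
        ≡⟨ xorSum-snoc p-1 (λ k → f (next k)) ⟩
      xorSum (λ k → f (next k)) p-1 xor f (next p-1)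
        ≡⟨ cong₂ _xor_ (xorSum-cong p-1 (λ k k<p-1 → cong f (next-suc k (s≤s k<p-1)))) (cong f next-last) ⟩
      xorSum (λ k → f (suc k)) p-1 xor f 0
        ≡⟨ xor-comm (xorSum (λ k → f (suc k)) p-1) (f 0) ⟩
      xorSum f p  ∎
    where open ≡-Reasoning

  xorSum-shift : ∀ a (c : ℕ → Bool) → xorSum (λ k → c (shift a k)) p ≡ xorSum c p
  xorSum-shift zero c = xorSum-cong p (λ k k<p → cong c (trans (cong (_% p) (+-identityʳ k)) (m<n⇒m%n≡m k<p)))
  xorSum-shift (suc a) c =
    trans (xorSum-cong p (λ k _ → cong c (shift-suc k)))
          (trans (xorSum-shift a (λ k → c (next k))) (xorSum-next c))
    where
      shift-suc : ∀ k → shift (suc a) k ≡ next (shift a k)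
      shift-suc k = trans (cong (_% p) (+-suc k a)) (sym ([m+n%p]%p≡[m+n]%p 1 (k + a)))

  cycleRanking-min : (c : ℕ → Bool) (a : ℕ) → a < p → c a ≡ false → xorSum c p ≡ false →
    Σ (CycleRanking c) λ ρ → ∀ i → i < p → i ≢ a → CycleRanking.rank ρ a < CycleRanking.rank ρ i
  cycleRanking-min c a a<p ca c-sum = ρ , minimum
    where
      open RankingFromZero (λ k → c (shift a k)) (trans (cong c (m<n⇒m%n≡m a<p)) ca)
                           (trans (xorSum-shift a c) c-sum)
      rank : ℕ → ℕ
      rank i = height (offset a i)
      cycleIn-rank : ∀ i → i < p → cycleIn rank i ≡ c i
      cycleIn-rank i i<p = begin
          (height (offset a (prev i)) <ᵇ rank i) xor (height (offset a (next i)) <ᵇ rank i)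
            ≡⟨ cong₂ (λ j k → (height j <ᵇ rank i) xor (height k <ᵇ rank i)) (offset-prev a i i<p) (offset-next a i) ⟩
          cycleIn height (offset a i)  ≡⟨ cycleIn-height (offset a i) (offset<p a i) ⟩
          c (shift a (offset a i))     ≡⟨ cong c (shift-offset a i a<p i<p) ⟩
          c i                          ∎
        where open ≡-Reasoning
      ρ : CycleRanking c
      ρ = record
        { rank = rank
        ; bound = p + p
        ; rank<bound = λ i → height<2p (offset a i) (offset<p a i)
        ; rank-next≢ = λ i _ eq → height-next≢ (offset a i) (offset<p a i) (trans (cong height (sym (offset-next a i))) eq)
        ; cycleIn≡ = cycleIn-rank
        }
      minimum : ∀ i → i < p → i ≢ a → rank a < rank i
      minimum i i<p i≢a with offset a i in eq
      ... | zero = ⊥-elim (i≢a (offset≡0⇒≡ a i a<p i<p eq))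
      ... | suc k = subst (λ j → height j < height (suc k)) (sym (offset-self a a<p))
                          (0<height k (subst (_< p) eq (offset<p a i)))

  -- Reflecting the ranking turns each in-degree d into 2 ∸ d.
  cycleRanking-max : (c : ℕ → Bool) (a : ℕ) → a < p → c a ≡ false → xorSum c p ≡ false →
    Σ (CycleRanking c) λ ρ → ∀ i → i < p → i ≢ a → CycleRanking.rank ρ i < CycleRanking.rank ρ a
  cycleRanking-max c a a<p ca c-sum = ρ , maximum
    where
      open CycleRanking (proj₁ (cycleRanking-min c a a<p ca c-sum))
      rank≤ : ∀ i → rank i ≤ bound
      rank≤ i = <⇒≤ (rank<bound i)
      reflected : ℕ → ℕ
      reflected i = bound ∸ rank i
      cycleIn-reflected : ∀ i → i < p → cycleIn reflected i ≡ c i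
      cycleIn-reflected i i<p = begin
          (bound ∸ rank (prev i) <ᵇ bound ∸ rank i) xor (bound ∸ rank (next i) <ᵇ bound ∸ rank i)
            ≡⟨ cong₂ _xor_ (<ᵇ-∸ˡ bound (rank (prev i)) (rank i) (rank≤ (prev i)) (rank≤ i))
                           (<ᵇ-∸ˡ bound (rank (next i)) (rank i) (rank≤ (next i)) (rank≤ i)) ⟩
          (rank i <ᵇ rank (prev i)) xor (rank i <ᵇ rank (next i))
            ≡⟨ cong₂ _xor_ (<ᵇ-flip rank-prev≢) (<ᵇ-flip (rank-next≢ i i<p)) ⟩
          not (rank (prev i) <ᵇ rank i) xor not (rank (next i) <ᵇ rank i)
            ≡⟨ xor-annihilates-not (rank (prev i) <ᵇ rank i) (rank (next i) <ᵇ rank i) ⟩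
          cycleIn rank i  ≡⟨ cycleIn≡ i i<p ⟩
          c i             ∎
        where
          open ≡-Reasoning
          rank-prev≢ : rank (prev i) ≢ rank i
          rank-prev≢ eq = rank-next≢ (prev i) (prev<p i i<p) (trans (cong rank (next-prev i i<p)) (sym eq))
      ρ : CycleRanking c
      ρ = record
        { rank = reflected
        ; bound = suc bound
        ; rank<bound = λ i → s≤s (m∸n≤m bound (rank i))
        ; rank-next≢ = λ i i<p eq → rank-next≢ i i<p (∸-cancelˡ-≡ (rank≤ (next i)) (rank≤ i) eq)
        ; cycleIn≡ = cycleIn-reflected
        }
      maximum : ∀ i → i < p → i ≢ a → reflected i < reflected a
      maximum i i<p i≢a = ∸-monoʳ-< (proj₂ (cycleRanking-min c a a<p ca c-sum) i i<p i≢a) (rank≤ i)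

-- Rankings of C_p □ P_q

module Rankings (n : ℕ) (n-even : parity n ≡ false) where
  open Cycle n n-even public

  Grid : Set
  Grid = ℕ → ℕ → Bool

  downIn : (ℕ → ℕ → ℕ) → ℕ → ℕ → Bool
  downIn r i zero = false
  downIn r i (suc j) = r i j <ᵇ r i (suc j)

  upIn : ℕ → (ℕ → ℕ → ℕ) → ℕ → ℕ → Bool
  upIn q r i j = if suc j <ᵇ q then r i (suc j) <ᵇ r i j else false

  inParity : ℕ → (ℕ → ℕ → ℕ) → ℕ → ℕ → Bool
  inParity q r i j = cycleIn (λ k → r k j) i xor (downIn r i j xor upIn q r i j)

  upIn-inner : ∀ q r i j → suc j < q → upIn q r i j ≡ (r i (suc j) <ᵇ r i j)
  upIn-inner q r i j j+1<q = if-true (<ᵇ-true j+1<q)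

  upIn-top : ∀ q r i j → q ≤ suc j → upIn q r i j ≡ false
  upIn-top q r i j q≤j+1 = if-false (<ᵇ-false q≤j+1)

  -- A ranking stands for the orientation of every edge towards the larger rank; T is the set of
  -- vertices of odd in-degree.
  record Ranking (q : ℕ) (T : Grid) : Set where
    field
      rank : ℕ → ℕ → ℕ
      bound : ℕ
      rank<bound : ∀ i j → rank i j < bound
      rank-next≢ : ∀ i j → i < p → j < q → rank (next i) j ≢ rank i j
      rank-up≢ : ∀ i j → i < p → suc j < q → rank i (suc j) ≢ rank i j
      inParity≡ : ∀ i j → i < p → j < q → inParity q rank i j ≡ T i j

  lowerTarget : ℕ → Grid → (ℕ → Bool) → Grid
  lowerTarget m T below i j = if j ≡ᵇ m then T i j xor below i else T i j

  lowerTarget-< : ∀ m T below i j → j < m → lowerTarget m T below i j ≡ T i j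
  lowerTarget-< m T below i j j<m = if-false (≡ᵇ-false (<⇒≢ j<m))

  lowerTarget-top : ∀ m T below i → lowerTarget m T below i m ≡ T i m xor below i
  lowerTarget-top m T below i = if-true (≡ᵇ-refl m)

  newRow : ℕ → Grid → (ℕ → Bool) → ℕ → Bool
  newRow m T below i = T i (suc m) xor not (below i)

  -- Stacking a new row m + 1, ranked by ρ, on a ranking of rows 0 … m: the vertices with `below`
  -- are put under all old vertices, the others over them. The vertical edge at column i then
  -- points into row m exactly when `below i`, which `lowerTarget` and the target of ρ account for.
  module Stack (m : ℕ) (T : Grid) (below : ℕ → Bool)
    (ρ : CycleRanking (newRow m T below))
    (below-lower : ∀ x y → x < p → y < p → below x ≡ true → below y ≡ false →
                   CycleRanking.rank ρ x < CycleRanking.rank ρ y)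
    (low : Ranking (suc m) (lowerTarget m T below)) where

    open CycleRanking ρ using () renaming (rank to s; bound to K; rank<bound to s<K; rank-next≢ to s-next≢; cycleIn≡ to top)
    open Ranking low

    topRank : ℕ → ℕ
    topRank i = if below i then s i else K + bound + s i

    stacked : ℕ → ℕ → ℕ
    stacked i j = if j <ᵇ suc m then K + rank i j else topRank i

    stacked-low : ∀ i j → j < suc m → stacked i j ≡ K + rank i j
    stacked-low i j j<m+1 = if-true (<ᵇ-true j<m+1)

    stacked-top : ∀ i → stacked i (suc m) ≡ topRank i
    stacked-top i = if-false (<ᵇ-irrefl (suc m))

    K≤K+bound+ : ∀ x → K ≤ K + bound + x
    K≤K+bound+ x = ≤-trans (m≤m+n K bound) (m≤m+n (K + bound) x)

    topRank-<ᵇ : ∀ x y → x < p → y < p → (topRank x <ᵇ topRank y) ≡ (s x <ᵇ s y)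
    topRank-<ᵇ x y x<p y<p with below x in bx | below y in by
    ... | true | true = refl
    ... | false | false = <ᵇ-+ˡ (K + bound) (s x) (s y)
    ... | true | false =
      trans (<ᵇ-true (<-≤-trans (s<K x) (K≤K+bound+ (s y)))) (sym (<ᵇ-true (below-lower x y x<p y<p bx by)))
    ... | false | true =
      trans (<ᵇ-false (≤-trans (<⇒≤ (s<K y)) (K≤K+bound+ (s x)))) (sym (<ᵇ-false (<⇒≤ (below-lower y x y<p x<p by bx))))

    topRank-below : ∀ i → (topRank i <ᵇ K + rank i m) ≡ below i
    topRank-below i with below i
    ... | true = <ᵇ-true (<-≤-trans (s<K i) (m≤m+n K (rank i m)))
    ... | false = <ᵇ-false (≤-trans (<⇒≤ (+-monoʳ-< K (rank<bound i m))) (m≤m+n (K + bound) (s i)))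

    topRank-above : ∀ i → (K + rank i m <ᵇ topRank i) ≡ not (below i)
    topRank-above i with below i
    ... | true = <ᵇ-false (≤-trans (<⇒≤ (s<K i)) (m≤m+n K (rank i m)))
    ... | false = <ᵇ-true (<-≤-trans (+-monoʳ-< K (rank<bound i m)) (m≤m+n (K + bound) (s i)))

    topRank-next≢ : ∀ i → i < p → topRank (next i) ≢ topRank i
    topRank-next≢ i i<p eq = s-next≢ i i<p (<ᵇ-antisym
      (trans (sym (topRank-<ᵇ (next i) i (next<p i) i<p)) (<ᵇ-false (≤-reflexive (sym eq))))
      (trans (sym (topRank-<ᵇ i (next i) i<p (next<p i))) (<ᵇ-false (≤-reflexive eq))))

    cycleIn-low : ∀ i j → j < suc m → cycleIn (λ k → stacked k j) i ≡ cycleIn (λ k → rank k j) i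
    cycleIn-low i j j<m+1 = begin
        (stacked (prev i) j <ᵇ stacked i j) xor (stacked (next i) j <ᵇ stacked i j)
          ≡⟨ cong₂ _xor_ (cong₂ _<ᵇ_ (stacked-low (prev i) j j<m+1) (stacked-low i j j<m+1))
                         (cong₂ _<ᵇ_ (stacked-low (next i) j j<m+1) (stacked-low i j j<m+1)) ⟩
        (K + rank (prev i) j <ᵇ K + rank i j) xor (K + rank (next i) j <ᵇ K + rank i j)
          ≡⟨ cong₂ _xor_ (<ᵇ-+ˡ K (rank (prev i) j) (rank i j)) (<ᵇ-+ˡ K (rank (next i) j) (rank i j)) ⟩
        cycleIn (λ k → rank k j) i  ∎
      where open ≡-Reasoning

    downIn-low : ∀ i j → j < suc m → downIn stacked i j ≡ downIn rank i j
    downIn-low i zero _ = refl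
    downIn-low i (suc j) j+1<m+1 =
      trans (cong₂ _<ᵇ_ (stacked-low i j (<-trans (n<1+n j) j+1<m+1)) (stacked-low i (suc j) j+1<m+1))
            (<ᵇ-+ˡ K (rank i j) (rank i (suc j)))

    upIn-low : ∀ i j → suc j < suc m → upIn (suc (suc m)) stacked i j ≡ upIn (suc m) rank i j
    upIn-low i j j+1<m+1 = begin
        upIn (suc (suc m)) stacked i j
          ≡⟨ upIn-inner (suc (suc m)) stacked i j (<-trans j+1<m+1 (n<1+n (suc m))) ⟩
        stacked i (suc j) <ᵇ stacked i j
          ≡⟨ cong₂ _<ᵇ_ (stacked-low i (suc j) j+1<m+1) (stacked-low i j (<-trans (n<1+n j) j+1<m+1)) ⟩
        K + rank i (suc j) <ᵇ K + rank i j
          ≡⟨ <ᵇ-+ˡ K (rank i (suc j)) (rank i j) ⟩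
        rank i (suc j) <ᵇ rank i j
          ≡⟨ upIn-inner (suc m) rank i j j+1<m+1 ⟨
        upIn (suc m) rank i j  ∎
      where open ≡-Reasoning

    inParity-below : ∀ i j → i < p → j < m → inParity (suc (suc m)) stacked i j ≡ T i j
    inParity-below i j i<p j<m = begin
        cycleIn (λ k → stacked k j) i xor (downIn stacked i j xor upIn (suc (suc m)) stacked i j)
          ≡⟨ cong₂ (λ x y → x xor (y xor upIn (suc (suc m)) stacked i j))
                   (cycleIn-low i j j<m+1) (downIn-low i j j<m+1) ⟩
        cycleIn (λ k → rank k j) i xor (downIn rank i j xor upIn (suc (suc m)) stacked i j)
          ≡⟨ cong (λ x → cycleIn (λ k → rank k j) i xor (downIn rank i j xor x)) (upIn-low i j (s≤s j<m)) ⟩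
        inParity (suc m) rank i j            ≡⟨ inParity≡ i j i<p j<m+1 ⟩
        lowerTarget m T below i j            ≡⟨ lowerTarget-< m T below i j j<m ⟩
        T i j                                ∎
      where
        open ≡-Reasoning
        j<m+1 = <-trans j<m (n<1+n m)

    inParity-row : ∀ i → i < p → inParity (suc (suc m)) stacked i m ≡ T i m
    inParity-row i i<p = begin
        cycleIn (λ k → stacked k m) i xor (downIn stacked i m xor upIn (suc (suc m)) stacked i m)
          ≡⟨ cong₂ (λ x y → x xor (y xor upIn (suc (suc m)) stacked i m)) (cycleIn-low i m ≤-refl) (downIn-low i m ≤-refl) ⟩
        cycleIn (λ k → rank k m) i xor (downIn rank i m xor upIn (suc (suc m)) stacked i m)
          ≡⟨ cong (λ x → cycleIn (λ k → rank k m) i xor (downIn rank i m xor x)) up-top ⟩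
        cycleIn (λ k → rank k m) i xor (downIn rank i m xor below i)
          ≡⟨ xor-assoc (cycleIn (λ k → rank k m) i) (downIn rank i m) (below i) ⟨
        (cycleIn (λ k → rank k m) i xor downIn rank i m) xor below i
          ≡⟨ cong (λ x → (cycleIn (λ k → rank k m) i xor x) xor below i) (xor-identityʳ (downIn rank i m)) ⟨
        (cycleIn (λ k → rank k m) i xor (downIn rank i m xor false)) xor below i
          ≡⟨ cong (λ x → (cycleIn (λ k → rank k m) i xor (downIn rank i m xor x)) xor below i)
                  (upIn-top (suc m) rank i m ≤-refl) ⟨
        inParity (suc m) rank i m xor below i
          ≡⟨ cong (_xor below i) (trans (inParity≡ i m i<p ≤-refl) (lowerTarget-top m T below i)) ⟩
        (T i m xor below i) xor below i      ≡⟨ xor-cancelʳ (T i m) (below i) ⟩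
        T i m                                ∎
      where
        open ≡-Reasoning
        up-top : upIn (suc (suc m)) stacked i m ≡ below i
        up-top = trans (upIn-inner (suc (suc m)) stacked i m ≤-refl)
                       (trans (cong₂ _<ᵇ_ (stacked-top i) (stacked-low i m ≤-refl)) (topRank-below i))

    inParity-top : ∀ i → i < p → inParity (suc (suc m)) stacked i (suc m) ≡ T i (suc m)
    inParity-top i i<p = begin
        cycleIn (λ k → stacked k (suc m)) i xor (downIn stacked i (suc m) xor upIn (suc (suc m)) stacked i (suc m))
          ≡⟨ cong₂ (λ x y → x xor (y xor upIn (suc (suc m)) stacked i (suc m))) cycleIn-top downIn-top ⟩
        cycleIn s i xor (not (below i) xor upIn (suc (suc m)) stacked i (suc m))
          ≡⟨ cong (λ x → cycleIn s i xor (not (below i) xor x)) (upIn-top (suc (suc m)) stacked i (suc m) ≤-refl) ⟩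
        cycleIn s i xor (not (below i) xor false)
          ≡⟨ cong (cycleIn s i xor_) (xor-identityʳ (not (below i))) ⟩
        cycleIn s i xor not (below i)              ≡⟨ cong (_xor not (below i)) (top i i<p) ⟩
        (T i (suc m) xor not (below i)) xor not (below i)  ≡⟨ xor-cancelʳ (T i (suc m)) (not (below i)) ⟩
        T i (suc m)                                ∎
      where
        open ≡-Reasoning
        cycleIn-top : cycleIn (λ k → stacked k (suc m)) i ≡ cycleIn s i
        cycleIn-top = trans
          (cong₂ _xor_ (cong₂ _<ᵇ_ (stacked-top (prev i)) (stacked-top i)) (cong₂ _<ᵇ_ (stacked-top (next i)) (stacked-top i)))
          (cong₂ _xor_ (topRank-<ᵇ (prev i) i (prev<p i i<p) i<p) (topRank-<ᵇ (next i) i (next<p i) i<p))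
        downIn-top : downIn stacked i (suc m) ≡ not (below i)
        downIn-top = trans (cong₂ _<ᵇ_ (stacked-low i m (n<1+n m)) (stacked-top i)) (topRank-above i)

    inParity-stacked : ∀ i j → i < p → j < suc (suc m) → inParity (suc (suc m)) stacked i j ≡ T i j
    inParity-stacked i j i<p j<m+2 with <2+-cases j<m+2
    ... | inj₁ j<m = inParity-below i j i<p j<m
    ... | inj₂ (inj₁ refl) = inParity-row i i<p
    ... | inj₂ (inj₂ refl) = inParity-top i i<p

    stacked-next≢ : ∀ i j → i < p → j < suc (suc m) → stacked (next i) j ≢ stacked i j
    stacked-next≢ i j i<p (s≤s j≤m+1) with m≤n⇒m<n∨m≡n j≤m+1
    ... | inj₁ j<m+1 = λ eq → rank-next≢ i j i<p j<m+1
          (+-cancelˡ-≡ K _ _ (trans (sym (stacked-low (next i) j j<m+1)) (trans eq (stacked-low i j j<m+1))))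
    ... | inj₂ refl = λ eq → topRank-next≢ i i<p (trans (sym (stacked-top (next i))) (trans eq (stacked-top i)))

    stacked-up≢ : ∀ i j → i < p → suc j < suc (suc m) → stacked i (suc j) ≢ stacked i j
    stacked-up≢ i j i<p (s≤s j+1≤m+1) with m≤n⇒m<n∨m≡n j+1≤m+1
    ... | inj₁ j+1<m+1 = λ eq → rank-up≢ i j i<p j+1<m+1
          (+-cancelˡ-≡ K _ _ (trans (sym (stacked-low i (suc j) j+1<m+1))
                                    (trans eq (stacked-low i j (<-trans (n<1+n j) j+1<m+1)))))
    ... | inj₂ refl = λ eq → top≢row (trans (sym (stacked-top i)) (trans eq (stacked-low i m ≤-refl)))
      where
        top≢row : topRank i ≢ K + rank i m
        top≢row e with () ← trans (cong not (sym (trans (sym (topRank-below i)) (<ᵇ-false (≤-reflexive (sym e))))))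
                                 (trans (sym (topRank-above i)) (<ᵇ-false (≤-reflexive e)))

    stacked<bound : ∀ i j → stacked i j < K + bound + K
    stacked<bound i j with j <ᵇ suc m
    ... | true = ≤-trans (+-monoʳ-< K (rank<bound i j)) (m≤m+n (K + bound) K)
    ... | false with below i
    ...   | true = <-≤-trans (s<K i) (K≤K+bound+ K)
    ...   | false = +-monoʳ-< (K + bound) (s<K i)

    ranking : Ranking (suc (suc m)) T
    ranking = record
      { rank = stacked
      ; bound = K + bound + K
      ; rank<bound = stacked<bound
      ; rank-next≢ = stacked-next≢
      ; rank-up≢ = stacked-up≢
      ; inParity≡ = inParity-stacked
      }

  module Reverse (Q : ℕ) (T : Grid) (ρ : Ranking (suc Q) (λ i j → T i (Q ∸ j))) where
    open Ranking ρ

    reversed : ℕ → ℕ → ℕ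
    reversed i j = rank i (Q ∸ j)

    Q∸j≡suc : ∀ j → j < Q → Q ∸ j ≡ suc (Q ∸ suc j)
    Q∸j≡suc j j<Q = +-∸-assoc 1 j<Q

    Q∸j+1<Q : ∀ j → j < Q → Q ∸ suc j < Q
    Q∸j+1<Q j j<Q = subst (_≤ Q) (Q∸j≡suc j j<Q) (m∸n≤m Q j)

    downIn-reversed : ∀ i j → j < suc Q → downIn reversed i j ≡ upIn (suc Q) rank i (Q ∸ j)
    downIn-reversed i zero _ = sym (upIn-top (suc Q) rank i Q ≤-refl)
    downIn-reversed i (suc j) (s≤s j<Q) = begin
        rank i (Q ∸ j) <ᵇ rank i (Q ∸ suc j)
          ≡⟨ cong (λ k → rank i k <ᵇ rank i (Q ∸ suc j)) (Q∸j≡suc j j<Q) ⟩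
        rank i (suc (Q ∸ suc j)) <ᵇ rank i (Q ∸ suc j)
          ≡⟨ upIn-inner (suc Q) rank i (Q ∸ suc j) (s≤s (Q∸j+1<Q j j<Q)) ⟨
        upIn (suc Q) rank i (Q ∸ suc j)  ∎
      where open ≡-Reasoning

    upIn-reversed : ∀ i j → j < suc Q → upIn (suc Q) reversed i j ≡ downIn rank i (Q ∸ j)
    upIn-reversed i j (s≤s j≤Q) with m≤n⇒m<n∨m≡n j≤Q
    ... | inj₁ j<Q = begin
        upIn (suc Q) reversed i j                   ≡⟨ upIn-inner (suc Q) reversed i j (s≤s j<Q) ⟩
        rank i (Q ∸ suc j) <ᵇ rank i (Q ∸ j)        ≡⟨ cong (λ k → rank i (Q ∸ suc j) <ᵇ rank i k) (Q∸j≡suc j j<Q) ⟩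
        downIn rank i (suc (Q ∸ suc j))             ≡⟨ cong (downIn rank i) (Q∸j≡suc j j<Q) ⟨
        downIn rank i (Q ∸ j)                       ∎
      where open ≡-Reasoning
    ... | inj₂ refl = trans (upIn-top (suc j) reversed i j ≤-refl) (cong (downIn rank i) (sym (n∸n≡0 j)))

    inParity-reversed : ∀ i j → i < p → j < suc Q → inParity (suc Q) reversed i j ≡ T i j
    inParity-reversed i j i<p j<Q+1 = begin
        cycleIn (λ k → rank k (Q ∸ j)) i xor (downIn reversed i j xor upIn (suc Q) reversed i j)
          ≡⟨ cong₂ (λ x y → cycleIn (λ k → rank k (Q ∸ j)) i xor (x xor y))
                   (downIn-reversed i j j<Q+1) (upIn-reversed i j j<Q+1) ⟩
        cycleIn (λ k → rank k (Q ∸ j)) i xor (upIn (suc Q) rank i (Q ∸ j) xor downIn rank i (Q ∸ j))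
          ≡⟨ cong (cycleIn (λ k → rank k (Q ∸ j)) i xor_) (xor-comm (upIn (suc Q) rank i (Q ∸ j)) _) ⟩
        inParity (suc Q) rank i (Q ∸ j)  ≡⟨ inParity≡ i (Q ∸ j) i<p (s≤s (m∸n≤m Q j)) ⟩
        T i (Q ∸ (Q ∸ j))                ≡⟨ cong (T i) (m∸[m∸n]≡n (≤-pred j<Q+1)) ⟩
        T i j                            ∎
      where open ≡-Reasoning

    ranking : Ranking (suc Q) T
    ranking = record
      { rank = reversed
      ; bound = bound
      ; rank<bound = λ i j → rank<bound i (Q ∸ j)
      ; rank-next≢ = λ i j i<p _ → rank-next≢ i (Q ∸ j) i<p (s≤s (m∸n≤m Q j))
      ; rank-up≢ = λ i j i<p j+1<Q+1 eq → rank-up≢ i (Q ∸ suc j) i<p (s≤s (Q∸j+1<Q j (≤-pred j+1<Q+1)))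
                     (trans (cong (rank i) (sym (Q∸j≡suc j (≤-pred j+1<Q+1)))) (sym eq))
      ; inParity≡ = inParity-reversed
      }

  -- A ranking of three rows whose odd in-degrees are exactly those of row 0. The rank is
  -- level * width + slot, so ranks are compared by level first and then by slot.
  module ThreeRows where

    width : ℕ
    width = suc p

    level : ℕ → ℕ → ℕ
    level i zero = if i <ᵇ p-1 then 1 else 6
    level i (suc zero) = if i ≡ᵇ 0 then 0 else (if i <ᵇ p-2 then 2 else (if i ≡ᵇ p-2 then 7 else 5))
    level i (suc (suc zero)) = if i <ᵇ p-1 then 3 else 4
    level i (suc (suc (suc _))) = 0

    slot : ℕ → ℕ → ℕ
    slot i zero = if i <ᵇ p-1 then i else 0
    slot i (suc zero) = if i <ᵇ p-2 then i else 0
    slot i (suc (suc zero)) = p ∸ i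
    slot i (suc (suc (suc _))) = 0

    rank : ℕ → ℕ → ℕ
    rank i j = level i j * width + slot i j

    level< : ∀ a b u v → a < b → u < width → a * width + u < b * width + v
    level< a b u v a<b u<width = <-≤-trans (+-monoʳ-< (a * width) u<width)
      (≤-trans (≤-reflexive (+-comm (a * width) width)) (≤-trans (*-monoˡ-≤ width a<b) (m≤m+n (b * width) v)))

    lowerLevel : ∀ {x y} a b {u v} → x ≡ a * width + u → y ≡ b * width + v → a < b → u < width → Comparison x y true
    lowerLevel a b {u} {v} refl refl a<b u<width = lower (level< a b u v a<b u<width)

    higherLevel : ∀ {x y} a b {u v} → x ≡ a * width + u → y ≡ b * width + v → b < a → v < width → Comparison x y false
    higherLevel a b {u} {v} refl refl b<a v<width = higher (level< b a v u b<a v<width)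

    lowerSlot : ∀ {x y} a {u v} → x ≡ a * width + u → y ≡ a * width + v → u < v → Comparison x y true
    lowerSlot a refl refl u<v = lower (+-monoʳ-< (a * width) u<v)

    higherSlot : ∀ {x y} a {u v} → x ≡ a * width + u → y ≡ a * width + v → v < u → Comparison x y false
    higherSlot a refl refl v<u = higher (+-monoʳ-< (a * width) v<u)

    0<width : 0 < width
    0<width = z<s

    <width : ∀ {i} → i < p-1 → i < width
    <width i<p-1 = <-trans i<p-1 (<-trans (n<1+n p-1) (n<1+n p))

    p∸<width : ∀ i → p ∸ i < width
    p∸<width i = s≤s (m∸n≤m p i)

    p∸-step : ∀ i → suc i ≤ p → p ∸ suc i < p ∸ i
    p∸-step i i<p = ∸-monoʳ-< (n<1+n i) i<p

    rank-0 : ∀ i → i < p-1 → rank i 0 ≡ 1 * width + i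
    rank-0 i i<p-1 = cong₂ (λ a b → a * width + b) (if-true (<ᵇ-true i<p-1)) (if-true (<ᵇ-true i<p-1))

    rank-0-last : rank p-1 0 ≡ 6 * width + 0
    rank-0-last = cong₂ (λ a b → a * width + b) (if-false (<ᵇ-irrefl p-1)) (if-false (<ᵇ-irrefl p-1))

    rank-1-first : rank 0 1 ≡ 0 * width + 0
    rank-1-first = refl

    rank-1 : ∀ k → suc k < p-2 → rank (suc k) 1 ≡ 2 * width + suc k
    rank-1 k k+1<p-2 = cong₂ (λ a b → a * width + b) (if-true (<ᵇ-true k+1<p-2)) (if-true (<ᵇ-true k+1<p-2))

    rank-1-penultimate : rank p-2 1 ≡ 7 * width + 0
    rank-1-penultimate = cong₂ (λ a b → a * width + b)
      (trans (if-false (<ᵇ-irrefl p-2)) (if-true (≡ᵇ-refl p-2))) (if-false (<ᵇ-irrefl p-2))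

    rank-1-last : rank p-1 1 ≡ 5 * width + 0
    rank-1-last = cong₂ (λ a b → a * width + b)
      (trans (if-false (<ᵇ-false (n≤1+n p-2))) (if-false (≡ᵇ-false {p-1} {p-2} 1+n≢n))) (if-false (<ᵇ-false (n≤1+n p-2)))

    rank-2 : ∀ i → i < p-1 → rank i 2 ≡ 3 * width + (p ∸ i)
    rank-2 i i<p-1 = cong (λ a → a * width + (p ∸ i)) (if-true (<ᵇ-true i<p-1))

    rank-2-last : rank p-1 2 ≡ 4 * width + (p ∸ p-1)
    rank-2-last = cong (λ a → a * width + (p ∸ p-1)) (if-false (<ᵇ-irrefl p-1))

    data Column : ℕ → Set where
      first : Column 0
      middle : ∀ k → suc k < p-2 → Column (suc k)
      penultimate : Column p-2
      last : Column p-1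

    column : ∀ i → i < p → Column i
    column zero _ = first
    column (suc k) (s≤s k≤p-1) with m≤n⇒m<n∨m≡n k≤p-1
    ... | inj₂ refl = last
    ... | inj₁ (s≤s k≤p-2) with m≤n⇒m<n∨m≡n k≤p-2
    ...   | inj₁ k+1<p-2 = middle k k+1<p-2
    ...   | inj₂ refl = penultimate

    row0 : ℕ → Bool
    row0 zero = true
    row0 (suc _) = false

    record Correct (i j : ℕ) : Set where
      field
        inParity≡ : inParity 3 rank i j ≡ row0 j
        rank-next≢ : rank (next i) j ≢ rank i j
        rank-up≢ : suc j < 3 → rank i (suc j) ≢ rank i j

    correct : ∀ i j {b₁ b₂ b₃ b₄} →
      Comparison (rank (prev i) j) (rank i j) b₁ → Comparison (rank (next i) j) (rank i j) b₂ →
      downIn rank i j ≡ b₃ → upIn 3 rank i j ≡ b₄ → (b₁ xor b₂) xor (b₃ xor b₄) ≡ row0 j →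
      (suc j < 3 → rank i (suc j) ≢ rank i j) → Correct i j
    correct i j prev-cmp next-cmp down up parity up≢ = record
      { inParity≡ = trans (cong₂ _xor_ (cong₂ _xor_ (Comparison-<ᵇ prev-cmp) (Comparison-<ᵇ next-cmp)) (cong₂ _xor_ down up))
                          parity
      ; rank-next≢ = Comparison-≢ next-cmp
      ; rank-up≢ = up≢
      }

    next-is : ∀ i {i′} j {b} → next i ≡ i′ → Comparison (rank i′ j) (rank i j) b → Comparison (rank (next i) j) (rank i j) b
    next-is i j refl cmp = cmp

    <p-2⇒<p-1 : ∀ {i} → i < p-2 → i < p-1
    <p-2⇒<p-1 i<p-2 = <-trans i<p-2 (n<1+n p-2)

    correct-row0 : ∀ i → i < p → Correct i 0
    correct-row0 i i<p with column i i<p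
    ... | first =
      correct 0 0 (higherLevel 6 1 rank-0-last (rank-0 0 z<s) decide< 0<width)
                  (higherSlot 1 (rank-0 1 decide<) (rank-0 0 z<s) decide<)
                  refl (Comparison-<ᵇ up) refl (λ _ → Comparison-≢ up)
      where up = lowerLevel {rank 0 1} {rank 0 0} 0 1 rank-1-first (rank-0 0 z<s) decide< 0<width
    ... | middle k k+1<p-2 =
      correct (suc k) 0 (lowerSlot 1 (rank-0 k (<-trans (n<1+n k) k+1<p-1)) (rank-0 (suc k) k+1<p-1) (n<1+n k))
                        (next-is (suc k) 0 (next-suc (suc k) (s≤s (<p-2⇒<p-1 k+1<p-2)))
                           (higherSlot 1 (rank-0 (suc (suc k)) (s≤s k+1<p-2)) (rank-0 (suc k) k+1<p-1) (n<1+n (suc k))))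
                        refl (Comparison-<ᵇ up) refl (λ _ → Comparison-≢ up)
      where k+1<p-1 = <p-2⇒<p-1 k+1<p-2
            up = higherLevel {rank (suc k) 1} {rank (suc k) 0} 2 1 (rank-1 k k+1<p-2) (rank-0 (suc k) k+1<p-1) decide< (<width k+1<p-1)
    ... | penultimate =
      correct p-2 0 (lowerSlot 1 (rank-0 (suc n) (<p-2⇒<p-1 (n<1+n (suc n)))) (rank-0 p-2 (n<1+n p-2)) (n<1+n (suc n)))
                    (next-is p-2 0 (next-suc p-2 (n<1+n p-1)) (higherLevel 6 1 rank-0-last (rank-0 p-2 (n<1+n p-2)) decide< (<width (n<1+n p-2))))
                    refl (Comparison-<ᵇ up) refl (λ _ → Comparison-≢ up)
      where up = higherLevel {rank p-2 1} {rank p-2 0} 7 1 rank-1-penultimate (rank-0 p-2 (n<1+n p-2)) decide< (<width (n<1+n p-2))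
    ... | last =
      correct p-1 0 (lowerLevel 1 6 (rank-0 p-2 (n<1+n p-2)) rank-0-last decide< (<width (n<1+n p-2)))
                    (next-is p-1 0 next-last (lowerLevel 1 6 (rank-0 0 z<s) rank-0-last decide< 0<width))
                    refl (Comparison-<ᵇ up) refl (λ _ → Comparison-≢ up)
      where up = lowerLevel {rank p-1 1} {rank p-1 0} 5 6 rank-1-last rank-0-last decide< 0<width

    prev-row1 : ∀ k → suc k < p-2 → Comparison (rank (prev (suc k)) 1) (rank (suc k) 1) true
    prev-row1 zero 1<p-2 = lowerLevel 0 2 rank-1-first (rank-1 0 1<p-2) decide< 0<width
    prev-row1 (suc k) k+2<p-2 = lowerSlot 2 (rank-1 k (<-trans (n<1+n (suc k)) k+2<p-2)) (rank-1 (suc k) k+2<p-2) (n<1+n (suc k))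

    correct-row1 : ∀ i → i < p → Correct i 1
    correct-row1 i i<p with column i i<p
    ... | first =
      correct 0 1 (higherLevel 5 0 rank-1-last rank-1-first decide< 0<width)
                  (higherLevel 2 0 (rank-1 0 decide<) rank-1-first decide< 0<width)
                  (Comparison-<ᵇ (higherLevel {rank 0 0} {rank 0 1} 1 0 (rank-0 0 z<s) rank-1-first decide< 0<width))
                  (Comparison-<ᵇ up) refl (λ _ → Comparison-≢ up)
      where up = higherLevel {rank 0 2} {rank 0 1} 3 0 (rank-2 0 z<s) rank-1-first decide< 0<width
    ... | middle k k+1<p-2 =
      correct (suc k) 1 (prev-row1 k k+1<p-2) next-cmp
                        (Comparison-<ᵇ (lowerLevel {rank (suc k) 0} {rank (suc k) 1} 1 2 (rank-0 (suc k) k+1<p-1) (rank-1 k k+1<p-2) decide< (<width k+1<p-1)))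
                        (Comparison-<ᵇ up) refl (λ _ → Comparison-≢ up)
      where
        k+1<p-1 = <p-2⇒<p-1 k+1<p-2
        up = higherLevel {rank (suc k) 2} {rank (suc k) 1} 3 2 (rank-2 (suc k) k+1<p-1) (rank-1 k k+1<p-2) decide< (<width k+1<p-1)
        next-cmp : Comparison (rank (next (suc k)) 1) (rank (suc k) 1) false
        next-cmp with m≤n⇒m<n∨m≡n k+1<p-2
        ... | inj₁ k+2<p-2 = next-is (suc k) 1 (next-suc (suc k) (s≤s k+1<p-1))
                               (higherSlot 2 (rank-1 (suc k) k+2<p-2) (rank-1 k k+1<p-2) (n<1+n (suc k)))
        ... | inj₂ k+2≡p-2 = next-is (suc k) 1 (trans (next-suc (suc k) (s≤s k+1<p-1)) k+2≡p-2)
                               (higherLevel 7 2 rank-1-penultimate (rank-1 k k+1<p-2) decide< (<width k+1<p-1))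
    ... | penultimate =
      correct p-2 1 (lowerLevel 2 7 (rank-1 n (n<1+n (suc n))) rank-1-penultimate decide< (<width (<p-2⇒<p-1 (n<1+n (suc n)))))
                    (next-is p-2 1 (next-suc p-2 (n<1+n p-1)) (lowerLevel 5 7 rank-1-last rank-1-penultimate decide< 0<width))
                    (Comparison-<ᵇ (lowerLevel {rank p-2 0} {rank p-2 1} 1 7 (rank-0 p-2 (n<1+n p-2)) rank-1-penultimate decide< (<width (n<1+n p-2))))
                    (Comparison-<ᵇ up) refl (λ _ → Comparison-≢ up)
      where up = lowerLevel {rank p-2 2} {rank p-2 1} 3 7 (rank-2 p-2 (n<1+n p-2)) rank-1-penultimate decide< (p∸<width p-2)
    ... | last =
      correct p-1 1 (higherLevel 7 5 rank-1-penultimate rank-1-last decide< 0<width)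
                    (next-is p-1 1 next-last (lowerLevel 0 5 rank-1-first rank-1-last decide< 0<width))
                    (Comparison-<ᵇ (higherLevel {rank p-1 0} {rank p-1 1} 6 5 rank-0-last rank-1-last decide< 0<width))
                    (Comparison-<ᵇ up) refl (λ _ → Comparison-≢ up)
      where up = lowerLevel {rank p-1 2} {rank p-1 1} 4 5 rank-2-last rank-1-last decide< (p∸<width p-1)

    no-row3 : ∀ i → 3 < 3 → rank i 3 ≢ rank i 2
    no-row3 i (s≤s (s≤s (s≤s ())))

    correct-row2 : ∀ i → i < p → Correct i 2
    correct-row2 i i<p with column i i<p
    ... | first =
      correct 0 2 (higherLevel 4 3 rank-2-last (rank-2 0 z<s) decide< (p∸<width 0))
                  (lowerSlot 3 (rank-2 1 decide<) (rank-2 0 z<s) (p∸-step 0 z<s))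
                  (Comparison-<ᵇ (lowerLevel {rank 0 1} {rank 0 2} 0 3 rank-1-first (rank-2 0 z<s) decide< 0<width))
                  refl refl (no-row3 0)
    ... | middle k k+1<p-2 =
      correct (suc k) 2 (higherSlot 3 (rank-2 k (<-trans (n<1+n k) k+1<p-1)) (rank-2 (suc k) k+1<p-1) (p∸-step k (<⇒≤ k+1<p)))
                        (next-is (suc k) 2 (next-suc (suc k) (s≤s k+1<p-1))
                           (lowerSlot 3 (rank-2 (suc (suc k)) (s≤s k+1<p-2)) (rank-2 (suc k) k+1<p-1) (p∸-step (suc k) k+1<p)))
                        (Comparison-<ᵇ (lowerLevel {rank (suc k) 1} {rank (suc k) 2} 2 3 (rank-1 k k+1<p-2) (rank-2 (suc k) k+1<p-1) decide< (<width k+1<p-1)))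
                        refl refl (no-row3 (suc k))
      where k+1<p-1 = <p-2⇒<p-1 k+1<p-2
            k+1<p = <-trans k+1<p-1 (n<1+n p-1)
    ... | penultimate =
      correct p-2 2 (higherSlot 3 (rank-2 (suc n) (<p-2⇒<p-1 (n<1+n (suc n)))) (rank-2 p-2 (n<1+n p-2)) (p∸-step (suc n) (<⇒≤ (<-trans (n<1+n p-2) (n<1+n p-1)))))
                    (next-is p-2 2 (next-suc p-2 (n<1+n p-1)) (higherLevel 4 3 rank-2-last (rank-2 p-2 (n<1+n p-2)) decide< (p∸<width p-2)))
                    (Comparison-<ᵇ (higherLevel {rank p-2 1} {rank p-2 2} 7 3 rank-1-penultimate (rank-2 p-2 (n<1+n p-2)) decide< (p∸<width p-2)))
                    refl refl (no-row3 p-2)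
    ... | last =
      correct p-1 2 (lowerLevel 3 4 (rank-2 p-2 (n<1+n p-2)) rank-2-last decide< (p∸<width p-2))
                    (next-is p-1 2 next-last (lowerLevel 3 4 (rank-2 0 z<s) rank-2-last decide< (p∸<width 0)))
                    (Comparison-<ᵇ (higherLevel {rank p-1 1} {rank p-1 2} 5 4 rank-1-last rank-2-last decide< (p∸<width p-1)))
                    refl refl (no-row3 p-1)

    correct-at : ∀ i j → i < p → j < 3 → Correct i j
    correct-at i zero i<p _ = correct-row0 i i<p
    correct-at i (suc zero) i<p _ = correct-row1 i i<p
    correct-at i (suc (suc zero)) i<p _ = correct-row2 i i<p
    correct-at i (suc (suc (suc j))) i<p (s≤s (s≤s (s≤s ())))

    level≤7 : ∀ i j → level i j ≤ 7
    level≤7 i zero with i <ᵇ p-1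
    ... | true = decide≤
    ... | false = decide≤
    level≤7 i (suc zero) with i ≡ᵇ 0 | i <ᵇ p-2 | i ≡ᵇ p-2
    ... | true | _ | _ = decide≤
    ... | false | true | _ = decide≤
    ... | false | false | true = decide≤
    ... | false | false | false = decide≤
    level≤7 i (suc (suc zero)) with i <ᵇ p-1
    ... | true = decide≤
    ... | false = decide≤
    level≤7 i (suc (suc (suc j))) = z≤n

    slot<width : ∀ i j → slot i j < width
    slot<width i zero with i <ᵇ p-1 in i<ᵇp-1
    ... | true = <width (<ᵇ-sound i<ᵇp-1)
    ... | false = 0<width
    slot<width i (suc zero) with i <ᵇ p-2 in i<ᵇp-2
    ... | true = <width (<p-2⇒<p-1 (<ᵇ-sound i<ᵇp-2))
    ... | false = 0<width
    slot<width i (suc (suc zero)) = p∸<width i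
    slot<width i (suc (suc (suc j))) = 0<width

    ranking : (T : Grid) → (∀ i → i < p → T i 0 ≡ true) → (∀ i → i < p → T i 1 ≡ false) →
              (∀ i → i < p → T i 2 ≡ false) → Ranking 3 T
    ranking T row0-true row1-false row2-false = record
      { rank = rank
      ; bound = 8 * width
      ; rank<bound = λ i j → subst (rank i j <_) (+-identityʳ (8 * width))
                                   (level< (level i j) 8 (slot i j) 0 (s≤s (level≤7 i j)) (slot<width i j))
      ; rank-next≢ = λ i j i<p j<3 → Correct.rank-next≢ (correct-at i j i<p j<3)
      ; rank-up≢ = λ i j i<p j+1<3 → Correct.rank-up≢ (correct-at i j i<p (<-trans (n<1+n j) j+1<3)) j+1<3
      ; inParity≡ = inParity≡
      }
      where
        inParity≡ : ∀ i j → i < p → j < 3 → inParity 3 rank i j ≡ T i j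
        inParity≡ i zero i<p j<3 = trans (Correct.inParity≡ (correct-at i 0 i<p j<3)) (sym (row0-true i i<p))
        inParity≡ i (suc zero) i<p j<3 = trans (Correct.inParity≡ (correct-at i 1 i<p j<3)) (sym (row1-false i i<p))
        inParity≡ i (suc (suc zero)) i<p j<3 = trans (Correct.inParity≡ (correct-at i 2 i<p j<3)) (sym (row2-false i i<p))
        inParity≡ i (suc (suc (suc j))) i<p (s≤s (s≤s (s≤s ())))

-- Admissible targets

module Induction (n : ℕ) (n-even : parity n ≡ false) where
  open Rankings n n-even public

  totalParity : ℕ → Grid → Bool
  totalParity q T = xorSum (λ i → xorSum (T i) q) p

  rowParity : Grid → ℕ → Bool
  rowParity T j = xorSum (λ i → T i j) p

  -- For q ≥ 2 the vertices of odd degree are those of rows 0 and q - 1, so (i , j) is a sink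
  -- of T exactly when T i j ≡ boundaryRow q j.
  boundaryRow : ℕ → ℕ → Bool
  boundaryRow q j = (j ≡ᵇ 0) ∨ (suc j ≡ᵇ q)

  HasSource : ℕ → Grid → Set
  HasSource q T = ∃ λ i → ∃ λ j → i < p × j < q × T i j ≡ false

  -- On a single row every degree is 2, so sinks and sources coincide.
  HasSink : ℕ → Grid → Set
  HasSink (suc (suc q)) T = ∃ λ i → ∃ λ j → i < p × j < suc (suc q) × T i j ≡ boundaryRow (suc (suc q)) j
  HasSink _ T = ⊤

  record Admissible (q : ℕ) (T : Grid) : Set where
    field
      even : totalParity q T ≡ false
      source : HasSource q T
      sink : HasSink q T

  Realisable : ℕ → Set
  Realisable q = ∀ T → Admissible q T → Ranking q T

  searchGrid : (P : Grid) (q : ℕ) →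
    (∀ i j → i < p → j < q → P i j ≡ false) ⊎ ∃ λ i → ∃ λ j → i < p × j < q × P i j ≡ true
  searchGrid P q = columns p
    where
      columns : ∀ k → (∀ i j → i < k → j < q → P i j ≡ false) ⊎ ∃ λ i → ∃ λ j → i < k × j < q × P i j ≡ true
      columns zero = inj₁ (λ i j ())
      columns (suc k) with columns k | search (P k) q
      ... | inj₂ (i , j , i<k , j<q , Pij) | _ = inj₂ (i , j , <-trans i<k (n<1+n k) , j<q , Pij)
      ... | inj₁ _ | inj₂ (j , j<q , Pkj) = inj₂ (k , j , n<1+n k , j<q , Pkj)
      ... | inj₁ before-k | inj₁ at-k = inj₁ λ i j i<k+1 j<q → case m≤n⇒m<n∨m≡n (≤-pred i<k+1) of λ
        { (inj₁ i<k) → before-k i j i<k j<q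
        ; (inj₂ refl) → at-k j j<q }

  source? : ∀ q T → HasSource q T ⊎ (∀ i j → i < p → j < q → T i j ≡ true)
  source? q T with searchGrid (λ i j → not (T i j)) q
  ... | inj₁ none = inj₂ (λ i j i<p j<q → not-injective (none i j i<p j<q))
  ... | inj₂ (i , j , i<p , j<q , Tij) = inj₁ (i , j , i<p , j<q , not-injective Tij)

  Sinkless : ℕ → Grid → Set
  Sinkless q T = ∀ i j → i < p → j < q → T i j ≡ not (boundaryRow q j)

  sink? : ∀ m T → HasSink (suc m) T ⊎ (∃ λ m′ → m ≡ suc m′ × Sinkless (suc m) T)
  sink? zero T = inj₁ tt
  sink? (suc m) T with searchGrid (λ i j → not (T i j xor boundaryRow (suc (suc m)) j)) (suc (suc m))
  ... | inj₂ (i , j , i<p , j<q , eq) = inj₁ (i , j , i<p , j<q , xor≡false⇒≡ (not-injective eq))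
  ... | inj₁ none = inj₂ (m , refl , λ i j i<p j<q → xor≡true⇒≡not (not-injective (none i j i<p j<q)))
    where
      xor≡true⇒≡not : ∀ {a b} → a xor b ≡ true → a ≡ not b
      xor≡true⇒≡not {false} {true} _ = refl
      xor≡true⇒≡not {true} {false} _ = refl

  sinkAtOrigin : ∀ m T → (0 < m → T 0 0 ≡ true) → HasSink (suc m) T
  sinkAtOrigin zero T _ = tt
  sinkAtOrigin (suc m) T T00 = 0 , 0 , z<s , z<s , T00 z<s

  boundaryRow-top : ∀ m → boundaryRow (suc m) m ≡ true
  boundaryRow-top m = trans (cong ((m ≡ᵇ 0) ∨_) (≡ᵇ-refl m)) (∨-zeroʳ (m ≡ᵇ 0))

  boundaryRow-< : ∀ m j → j < m → boundaryRow (suc (suc m)) j ≡ boundaryRow (suc m) j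
  boundaryRow-< m j j<m = cong ((j ≡ᵇ 0) ∨_)
    (trans (≡ᵇ-false (λ eq → <⇒≢ (<-trans j<m (n<1+n m)) (suc-injective eq)))
           (sym (≡ᵇ-false (λ eq → <⇒≢ j<m (suc-injective eq)))))

  boundaryRow-inner : ∀ m → boundaryRow (suc (suc (suc m))) (suc m) ≡ false
  boundaryRow-inner m = ≡ᵇ-false (<⇒≢ (n<1+n (suc (suc m))))

  totalParity-snoc : ∀ q T → totalParity (suc q) T ≡ totalParity q T xor rowParity T q
  totalParity-snoc q T =
    trans (xorSum-cong p (λ i _ → xorSum-snoc q (T i))) (xorSum-xor p (λ i → xorSum (T i) q) (λ i → T i q))

  RowConstant : ℕ → Grid → Set
  RowConstant q T = ∀ i j → i < p → j < q → T i j ≡ T 0 j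

  totalParity-RowConstant : ∀ q T → RowConstant q T → totalParity q T ≡ false
  totalParity-RowConstant q T constant =
    trans (xorSum-cong p (λ i i<p → xorSum-cong q (λ j j<q → constant i j i<p j<q)))
          (xorSum-const-p (xorSum (T 0) q))

  -- This makes both the lower target and the target of the new row even.
  Balanced : ℕ → Grid → (ℕ → Bool) → Set
  Balanced m T below = xorSum below p ≡ rowParity T (suc m)

  totalParity-lowerTarget : ∀ m T below → totalParity (suc (suc m)) T ≡ false → Balanced m T below →
    totalParity (suc m) (lowerTarget m T below) ≡ false
  totalParity-lowerTarget m T below even balanced = begin
      totalParity (suc m) (lowerTarget m T below)    ≡⟨ xorSum-cong p (λ i _ → column i) ⟩
      xorSum (λ i → xorSum (T i) (suc m) xor below i) p
        ≡⟨ xorSum-xor p (λ i → xorSum (T i) (suc m)) below ⟩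
      totalParity (suc m) T xor xorSum below p       ≡⟨ cong (totalParity (suc m) T xor_) balanced ⟩
      totalParity (suc m) T xor rowParity T (suc m)  ≡⟨ totalParity-snoc (suc m) T ⟨
      totalParity (suc (suc m)) T                    ≡⟨ even ⟩
      false                                          ∎
    where
      open ≡-Reasoning
      column : ∀ i → xorSum (lowerTarget m T below i) (suc m) ≡ xorSum (T i) (suc m) xor below i
      column i = begin
          xorSum (lowerTarget m T below i) (suc m)
            ≡⟨ xorSum-snoc m (lowerTarget m T below i) ⟩
          xorSum (lowerTarget m T below i) m xor lowerTarget m T below i m
            ≡⟨ cong₂ _xor_ (xorSum-cong m (λ j j<m → lowerTarget-< m T below i j j<m)) (lowerTarget-top m T below i) ⟩
          xorSum (T i) m xor (T i m xor below i)  ≡⟨ xor-assoc (xorSum (T i) m) (T i m) (below i) ⟨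
          (xorSum (T i) m xor T i m) xor below i  ≡⟨ cong (_xor below i) (xorSum-snoc m (T i)) ⟨
          xorSum (T i) (suc m) xor below i        ∎

  newRow-sum : ∀ m T below → Balanced m T below → xorSum (newRow m T below) p ≡ false
  newRow-sum m T below balanced =
    trans (xorSum-xor p (λ i → T i (suc m)) (λ i → not (below i)))
          (trans (cong (rowParity T (suc m) xor_) (trans (xorSum-not-p below) balanced)) (xor-same (rowParity T (suc m))))

  only : ℕ → ℕ → Bool
  only a i = i ≡ᵇ a

  allBut : ℕ → ℕ → Bool
  allBut b i = not (i ≡ᵇ b)

  module _ (m : ℕ) (T : Grid) where

    balanced-above : rowParity T (suc m) ≡ false → Balanced m T (λ _ → false)
    balanced-above even = trans (xorSum-false p) (sym even)

    balanced-below : rowParity T (suc m) ≡ false → Balanced m T (λ _ → true)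
    balanced-below even = trans (xorSum-const-p true) (sym even)

    balanced-oneBelow : ∀ a → a < p → rowParity T (suc m) ≡ true → Balanced m T (only a)
    balanced-oneBelow a a<p odd = trans (xorSum-indicator p a a<p) (sym odd)

    balanced-oneAbove : ∀ b → b < p → rowParity T (suc m) ≡ true → Balanced m T (allBut b)
    balanced-oneAbove b b<p odd = trans (xorSum-not-p (only b)) (balanced-oneBelow b b<p odd)

    stackAbove : ∀ a → a < p → T a (suc m) ≡ true → rowParity T (suc m) ≡ false →
      Ranking (suc m) (lowerTarget m T (λ _ → false)) → Ranking (suc (suc m)) T
    stackAbove a a<p Ta even = Stack.ranking m T (λ _ → false) (proj₁ min) (λ _ _ _ _ ())
      where
        min = cycleRanking-min (newRow m T (λ _ → false)) a a<p (cong (_xor true) Ta)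
                               (newRow-sum m T (λ _ → false) (balanced-above even))

    stackBelow : ∀ a → a < p → T a (suc m) ≡ false → rowParity T (suc m) ≡ false →
      Ranking (suc m) (lowerTarget m T (λ _ → true)) → Ranking (suc (suc m)) T
    stackBelow a a<p Ta even = Stack.ranking m T (λ _ → true) (proj₁ min) (λ _ _ _ _ _ ())
      where
        min = cycleRanking-min (newRow m T (λ _ → true)) a a<p (trans (xor-identityʳ (T a (suc m))) Ta)
                               (newRow-sum m T (λ _ → true) (balanced-below even))

    stackOneBelow : ∀ a → a < p → T a (suc m) ≡ false → rowParity T (suc m) ≡ true →
      Ranking (suc m) (lowerTarget m T (only a)) → Ranking (suc (suc m)) T
    stackOneBelow a a<p Ta odd = Stack.ranking m T (only a) (proj₁ min) lowest
      where
        min = cycleRanking-min (newRow m T (only a)) a a<p (cong₂ (λ t e → t xor not e) Ta (≡ᵇ-refl a))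
                               (newRow-sum m T (only a) (balanced-oneBelow a a<p odd))
        open CycleRanking (proj₁ min) using (rank)
        lowest : ∀ x y → x < p → y < p → (x ≡ᵇ a) ≡ true → (y ≡ᵇ a) ≡ false → rank x < rank y
        lowest x y _ y<p x≡a y≢a =
          subst (λ z → rank z < rank y) (sym (≡ᵇ-sound {x} {a} x≡a)) (proj₂ min y y<p (≡ᵇ-false⇒≢ {y} {a} y≢a))

    stackOneAbove : ∀ b → b < p → T b (suc m) ≡ true → rowParity T (suc m) ≡ true →
      Ranking (suc m) (lowerTarget m T (allBut b)) → Ranking (suc (suc m)) T
    stackOneAbove b b<p Tb odd = Stack.ranking m T (allBut b) (proj₁ max) lowest
      where
        max = cycleRanking-max (newRow m T (allBut b)) b b<p (cong₂ (λ t e → t xor not (not e)) Tb (≡ᵇ-refl b))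
                               (newRow-sum m T (allBut b) (balanced-oneAbove b b<p odd))
        open CycleRanking (proj₁ max) using (rank)
        lowest : ∀ x y → x < p → y < p → not (x ≡ᵇ b) ≡ true → not (y ≡ᵇ b) ≡ false → rank x < rank y
        lowest x y x<p _ x≢b y≡b =
          subst (λ z → rank x < rank z) (sym (≡ᵇ-sound {y} {b} (not-injective y≡b)))
                (proj₂ max x x<p (≡ᵇ-false⇒≢ {x} {b} (not-injective x≢b)))

  RowConstant-init : ∀ q T → RowConstant (suc q) T → RowConstant q T
  RowConstant-init q T constant i j i<p j<q = constant i j i<p (<-trans j<q (n<1+n q))

  RowConstant-lowerTarget : ∀ m T b → RowConstant (suc m) T → RowConstant (suc m) (lowerTarget m T (λ _ → b))
  RowConstant-lowerTarget m T b constant i j i<p j<m+1 =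
    cong (λ t → if j ≡ᵇ m then t xor b else t) (constant i j i<p j<m+1)

  RowConstant-reverse : ∀ Q T → RowConstant (suc Q) T → RowConstant (suc Q) (λ i j → T i (Q ∸ j))
  RowConstant-reverse Q T constant i j i<p _ = constant i (Q ∸ j) i<p (s≤s (m∸n≤m Q j))

  -- On the next two targets no choice of `below` works directly, but one does after reversing the
  -- rows (three rows excepted, which ThreeRows handles).

  lowerRowsTrue : ∀ m T → Realisable (suc m) → HasSink (suc (suc m)) T →
    (∀ i j → i < p → j < m → T i j ≡ true) → (∀ i → i < p → T i m ≡ false) →
    (∀ i → i < p → T i (suc m) ≡ false) → Ranking (suc (suc m)) T
  lowerRowsTrue zero T _ (i , zero , i<p , _ , sink) _ row0 _ = ⊥-elim (true≢false (trans (sym sink) (row0 i i<p)))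
  lowerRowsTrue zero T _ (i , suc zero , i<p , _ , sink) _ _ row1 = ⊥-elim (true≢false (trans (sym sink) (row1 i i<p)))
  lowerRowsTrue zero T _ (_ , suc (suc _) , _ , s≤s (s≤s ()) , _) _ _ _
  lowerRowsTrue (suc zero) T _ _ rows-true row1 row2 = ThreeRows.ranking T (λ i i<p → rows-true i 0 i<p z<s) row1 row2
  lowerRowsTrue m@(suc (suc _)) T ih _ rows-true row-m top =
    Reverse.ranking (suc m) T (stackAbove m reversed 0 z<s (reversed-top 0 z<s) top-even
                                  (ih (lowerTarget m reversed (λ _ → false)) admissible))
    where
      reversed : Grid
      reversed i j = T i (suc m ∸ j)
      reversed-top : ∀ i → i < p → reversed i (suc m) ≡ true
      reversed-top i i<p = trans (cong (T i) (n∸n≡0 (suc m))) (rows-true i 0 i<p z<s)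
      top-even : rowParity reversed (suc m) ≡ false
      top-even = trans (xorSum-cong p reversed-top) (xorSum-const-p true)
      constant : RowConstant (suc (suc m)) T
      constant i j i<p j<m+2 with <2+-cases j<m+2
      ... | inj₁ j<m = trans (rows-true i j i<p j<m) (sym (rows-true 0 j z<s j<m))
      ... | inj₂ (inj₁ refl) = trans (row-m i i<p) (sym (row-m 0 z<s))
      ... | inj₂ (inj₂ refl) = trans (top i i<p) (sym (top 0 z<s))
      admissible : Admissible (suc m) (lowerTarget m reversed (λ _ → false))
      admissible = record
        { even = totalParity-RowConstant (suc m) _ (RowConstant-lowerTarget m reversed false
                   (RowConstant-init (suc m) reversed (RowConstant-reverse (suc m) T constant)))
        ; source = 0 , 0 , z<s , z<s , trans (lowerTarget-< m reversed (λ _ → false) 0 0 z<s) (top 0 z<s)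
        ; sink = 0 , m , z<s , n<1+n m ,
                 trans (lowerTarget-top m reversed (λ _ → false) 0)
                       (trans (xor-identityʳ _) (trans (cong (T 0) (m+n∸n≡m 1 m))
                              (trans (rows-true 0 1 z<s (s≤s (s≤s z≤n))) (sym (boundaryRow-top m)))))
        }

  innerRowsTrue : ∀ m T → Realisable (suc m) → 0 < m → Sinkless (suc m) T →
    (∀ i → i < p → T i (suc m) ≡ true) → Ranking (suc (suc m)) T
  innerRowsTrue (suc zero) T _ _ sinkless top =
    Reverse.ranking 2 T (ThreeRows.ranking _ top (λ i i<p → sinkless i 1 i<p ≤-refl) (λ i i<p → sinkless i 0 i<p z<s))
  innerRowsTrue m@(suc (suc _)) T ih _ sinkless top =
    Reverse.ranking (suc m) T (stackBelow m reversed 0 z<s (reversed-top 0 z<s) top-even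
                                  (ih (lowerTarget m reversed (λ _ → true)) admissible))
    where
      reversed : Grid
      reversed i j = T i (suc m ∸ j)
      reversed-top : ∀ i → i < p → reversed i (suc m) ≡ false
      reversed-top i i<p = trans (cong (T i) (n∸n≡0 (suc m))) (sinkless i 0 i<p z<s)
      top-even : rowParity reversed (suc m) ≡ false
      top-even = xorSum-allFalse p reversed-top
      constant : RowConstant (suc (suc m)) T
      constant i j i<p j<m+2 with <2+-cases j<m+2
      ... | inj₁ j<m = trans (sinkless i j i<p j<m+1) (sym (sinkless 0 j z<s j<m+1))
        where j<m+1 = <-trans j<m (n<1+n m)
      ... | inj₂ (inj₁ refl) = trans (sinkless i m i<p (n<1+n m)) (sym (sinkless 0 m z<s (n<1+n m)))
      ... | inj₂ (inj₂ refl) = trans (top i i<p) (sym (top 0 z<s))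
      admissible : Admissible (suc m) (lowerTarget m reversed (λ _ → true))
      admissible = record
        { even = totalParity-RowConstant (suc m) _ (RowConstant-lowerTarget m reversed true
                   (RowConstant-init (suc m) reversed (RowConstant-reverse (suc m) T constant)))
        ; source = 0 , 1 , z<s , s≤s (s≤s z≤n) ,
                   trans (lowerTarget-< m reversed (λ _ → true) 0 1 (s≤s (s≤s z≤n)))
                         (trans (sinkless 0 m z<s (n<1+n m)) (cong not (boundaryRow-top m)))
        ; sink = 0 , 0 , z<s , z<s , trans (lowerTarget-< m reversed (λ _ → true) 0 0 z<s) (top 0 z<s)
        }

  -- The parity of row m + 1 dictates a choice of `below`; when the lower target it leaves has no
  -- source or no sink, the alternative choice (or one of the two special targets) works.
  module Step (m : ℕ) (T : Grid) (admissible : Admissible (suc (suc m)) T) (ih : Realisable (suc m)) where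
    open Admissible admissible

    realiseLower : ∀ below → Balanced m T below → HasSource (suc m) (lowerTarget m T below) →
      HasSink (suc m) (lowerTarget m T below) → Ranking (suc m) (lowerTarget m T below)
    realiseLower below balanced src snk = ih (lowerTarget m T below) record
      { even = totalParity-lowerTarget m T below even balanced ; source = src ; sink = snk }

    lowerTarget-agree : ∀ below below′ i j → j < m → lowerTarget m T below i j ≡ lowerTarget m T below′ i j
    lowerTarget-agree below below′ i j j<m =
      trans (lowerTarget-< m T below i j j<m) (sym (lowerTarget-< m T below′ i j j<m))

    lowerTarget-unflagged : ∀ below i → below i ≡ false → lowerTarget m T below i m ≡ T i m
    lowerTarget-unflagged below i unflagged =
      trans (lowerTarget-top m T below i) (trans (cong (T i m xor_) unflagged) (xor-identityʳ (T i m)))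

    lowerTarget-flagged : ∀ below i → below i ≡ true → lowerTarget m T below i m ≡ not (T i m)
    lowerTarget-flagged below i flagged =
      trans (lowerTarget-top m T below i) (trans (cong (T i m xor_) flagged) (xor-trueʳ (T i m)))

    lowerTarget-none : ∀ i j → j < suc m → lowerTarget m T (λ _ → false) i j ≡ T i j
    lowerTarget-none i j (s≤s j≤m) with m≤n⇒m<n∨m≡n j≤m
    ... | inj₁ j<m = lowerTarget-< m T (λ _ → false) i j j<m
    ... | inj₂ refl = lowerTarget-unflagged (λ _ → false) i refl

    module OddRow (odd : rowParity T (suc m) ≡ true) (a : ℕ) (a<p : a < p) (Ta : T a (suc m) ≡ false)
                  (b : ℕ) (b<p : b < p) (Tb : T b (suc m) ≡ true) where

      oneAbove : HasSource (suc m) (lowerTarget m T (allBut b)) →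
                 HasSink (suc m) (lowerTarget m T (allBut b)) → Ranking (suc (suc m)) T
      oneAbove src snk = stackOneAbove m T b b<p Tb odd (realiseLower (allBut b) (balanced-oneAbove m T b b<p odd) src snk)

      c : ℕ
      c = proj₁ (avoid2 a b)

      c<p : c < p
      c<p = <-trans (proj₁ (proj₂ (avoid2 a b))) 3<p

      c-unflagged : (c ≡ᵇ a) ≡ false
      c-unflagged = ≡ᵇ-false (proj₁ (proj₂ (proj₂ (avoid2 a b))))

      c-flagged : not (c ≡ᵇ b) ≡ true
      c-flagged = cong not (≡ᵇ-false (proj₂ (proj₂ (proj₂ (avoid2 a b)))))

      ranking : Ranking (suc (suc m)) T
      ranking with source? (suc m) (lowerTarget m T (only a)) | sink? m (lowerTarget m T (only a))
      ... | inj₁ src | inj₁ snk = stackOneBelow m T a a<p Ta odd (realiseLower (only a) (balanced-oneBelow m T a a<p odd) src snk)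
      ... | inj₁ _ | inj₂ (m′ , refl , sinkless) = oneAbove
            (0 , 0 , z<s , z<s , trans (lowerTarget-agree (allBut b) (only a) 0 0 z<s) (sinkless 0 0 z<s z<s))
            (c , m , c<p , n<1+n m , trans (lowerTarget-flagged (allBut b) c c-flagged) (trans (cong not Tcm) (sym (boundaryRow-top m))))
        where
          Tcm : T c m ≡ false
          Tcm = trans (sym (lowerTarget-unflagged (only a) c c-unflagged)) (trans (sinkless c m c<p (n<1+n m)) (cong not (boundaryRow-top m)))
      ... | inj₂ full | _ = oneAbove
            (c , m , c<p , n<1+n m , trans (lowerTarget-flagged (allBut b) c c-flagged) (cong not Tcm))
            (sinkAtOrigin m (lowerTarget m T (allBut b)) (λ 0<m → trans (lowerTarget-agree (allBut b) (only a) 0 0 0<m) (full 0 0 z<s z<s)))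
        where
          Tcm : T c m ≡ true
          Tcm = trans (sym (lowerTarget-unflagged (only a) c c-unflagged)) (full c m c<p (n<1+n m))

    sinkless-contradiction : 0 < m → Sinkless (suc m) (lowerTarget m T (λ _ → true)) →
      (∀ i → i < p → T i (suc m) ≡ false) → ¬ HasSink (suc (suc m)) T
    sinkless-contradiction (s≤s {n = m′} z≤n) sinkless top-false (i , j , i<p , j<m+2 , Tij) with <2+-cases j<m+2
    ... | inj₁ j<m = ≢not (T i j) (begin
        T i j                             ≡⟨ lowerTarget-< m T (λ _ → true) i j j<m ⟨
        lowerTarget m T (λ _ → true) i j  ≡⟨ sinkless i j i<p (<-trans j<m (n<1+n m)) ⟩
        not (boundaryRow (suc m) j)       ≡⟨ cong not (boundaryRow-< m j j<m) ⟨
        not (boundaryRow (suc (suc m)) j) ≡⟨ cong not Tij ⟨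
        not (T i j)                       ∎)
      where open ≡-Reasoning
    ... | inj₂ (inj₁ refl) = true≢false (trans (sym Tim) (trans Tij (boundaryRow-inner m′)))
      where
        Tim : T i m ≡ true
        Tim = trans (sym (not-involutive (T i m)))
                    (cong not (trans (sym (lowerTarget-flagged (λ _ → true) i refl))
                                     (trans (sinkless i m i<p (n<1+n m)) (cong not (boundaryRow-top m)))))
    ... | inj₂ (inj₂ refl) = true≢false (trans (sym (boundaryRow-top (suc m))) (trans (sym Tij) (top-false i i<p)))

    module EvenRow (even : rowParity T (suc m) ≡ false) where

      above : ∀ a → a < p → T a (suc m) ≡ true → HasSource (suc m) (lowerTarget m T (λ _ → false)) →
              HasSink (suc m) (lowerTarget m T (λ _ → false)) → Ranking (suc (suc m)) T
      above a a<p Ta src snk = stackAbove m T a a<p Ta even (realiseLower (λ _ → false) (balanced-above m T even) src snk)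

      below : ∀ a → a < p → T a (suc m) ≡ false → HasSource (suc m) (lowerTarget m T (λ _ → true)) →
              HasSink (suc m) (lowerTarget m T (λ _ → true)) → Ranking (suc (suc m)) T
      below a a<p Ta src snk = stackBelow m T a a<p Ta even (realiseLower (λ _ → true) (balanced-below m T even) src snk)

      allFalse : (∀ i → i < p → T i (suc m) ≡ false) → Ranking (suc (suc m)) T
      allFalse top-false with source? (suc m) (lowerTarget m T (λ _ → true)) | sink? m (lowerTarget m T (λ _ → true))
      ... | inj₁ src | inj₁ snk = below 0 z<s (top-false 0 z<s) src snk
      ... | inj₁ _ | inj₂ (m′ , refl , sinkless) = ⊥-elim (sinkless-contradiction z<s sinkless top-false sink)
      ... | inj₂ full | _ = lowerRowsTrue m T ih sink rows-true row-m top-false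
        where
          rows-true : ∀ i j → i < p → j < m → T i j ≡ true
          rows-true i j i<p j<m = trans (sym (lowerTarget-< m T (λ _ → true) i j j<m)) (full i j i<p (<-trans j<m (n<1+n m)))
          row-m : ∀ i → i < p → T i m ≡ false
          row-m i i<p = not-injective (trans (sym (lowerTarget-flagged (λ _ → true) i refl)) (full i m i<p (n<1+n m)))

      allTrue : (∀ i → i < p → T i (suc m) ≡ true) → Ranking (suc (suc m)) T
      allTrue top-true with source? (suc m) (lowerTarget m T (λ _ → false)) | sink? m (lowerTarget m T (λ _ → false))
      ... | inj₁ src | inj₁ snk = above 0 z<s (top-true 0 z<s) src snk
      ... | inj₁ _ | inj₂ (m′ , refl , sinkless) = innerRowsTrue m T ih z<s
            (λ i j i<p j<m+1 → trans (sym (lowerTarget-none i j j<m+1)) (sinkless i j i<p j<m+1)) top-true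
      ... | inj₂ full | _ with source
      ...   | i , j , i<p , j<m+2 , Tij with m≤n⇒m<n∨m≡n (≤-pred j<m+2)
      ...     | inj₁ j<m+1 = ⊥-elim (true≢false (trans (sym (full i j i<p j<m+1)) (trans (lowerTarget-none i j j<m+1) Tij)))
      ...     | inj₂ refl = ⊥-elim (true≢false (trans (sym (top-true i i<p)) Tij))

      mixed : ∀ a → a < p → T a (suc m) ≡ true → ∀ a′ → a′ < p → T a′ (suc m) ≡ false → Ranking (suc (suc m)) T
      mixed a a<p Ta a′ a′<p Ta′ with source? (suc m) (lowerTarget m T (λ _ → false)) | sink? m (lowerTarget m T (λ _ → false))
      ... | inj₁ src | inj₁ snk = above a a<p Ta src snk
      ... | inj₁ _ | inj₂ (m′ , refl , sinkless) = below a′ a′<p Ta′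
            (0 , 0 , z<s , z<s , trans (lowerTarget-agree (λ _ → true) (λ _ → false) 0 0 z<s) (sinkless 0 0 z<s z<s))
            (0 , m , z<s , n<1+n m , trans (lowerTarget-flagged (λ _ → true) 0 refl) (trans (cong not T0m) (sym (boundaryRow-top m))))
        where
          T0m : T 0 m ≡ false
          T0m = trans (sym (lowerTarget-none 0 m (n<1+n m))) (trans (sinkless 0 m z<s (n<1+n m)) (cong not (boundaryRow-top m)))
      ... | inj₂ full | _ = below a′ a′<p Ta′
            (0 , m , z<s , n<1+n m , trans (lowerTarget-flagged (λ _ → true) 0 refl) (cong not T0m))
            (sinkAtOrigin m (lowerTarget m T (λ _ → true)) (λ 0<m → trans (lowerTarget-agree (λ _ → true) (λ _ → false) 0 0 0<m) (full 0 0 z<s z<s)))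
        where
          T0m : T 0 m ≡ true
          T0m = trans (sym (lowerTarget-none 0 m (n<1+n m))) (full 0 m z<s (n<1+n m))

    ranking : Ranking (suc (suc m)) T
    ranking with rowParity T (suc m) in top-parity | search (λ i → T i (suc m)) p | search (λ i → not (T i (suc m))) p
    ... | true | inj₂ (b , b<p , Tb) | inj₂ (a , a<p , Ta) = OddRow.ranking top-parity a a<p (not-injective Ta) b b<p Tb
    ... | true | inj₁ none-true | _ = ⊥-elim (true≢false (trans (sym top-parity) (xorSum-allFalse p none-true)))
    ... | true | inj₂ _ | inj₁ none-false = ⊥-elim (true≢false (trans (sym top-parity)
          (trans (xorSum-cong p (λ i i<p → not-injective (none-false i i<p))) (xorSum-const-p true))))
    ... | false | inj₁ none-true | _ = EvenRow.allFalse top-parity none-true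
    ... | false | inj₂ _ | inj₁ none-false = EvenRow.allTrue top-parity (λ i i<p → not-injective (none-false i i<p))
    ... | false | inj₂ (a , a<p , Ta) | inj₂ (a′ , a′<p , Ta′) = EvenRow.mixed top-parity a a<p Ta a′ a′<p (not-injective Ta′)

  oneRow : Realisable 1
  oneRow T admissible with Admissible.source admissible
  ... | a , zero , a<p , _ , Ta0 = record
    { rank = λ i _ → rank i
    ; bound = bound
    ; rank<bound = λ i _ → rank<bound i
    ; rank-next≢ = λ i _ i<p _ → rank-next≢ i i<p
    ; rank-up≢ = λ { _ _ _ (s≤s ()) }
    ; inParity≡ = λ { i zero i<p _ → trans (xor-identityʳ (cycleIn rank i)) (cycleIn≡ i i<p)
                    ; _ (suc _) _ (s≤s ()) }
    }
    where
      row-even : xorSum (λ i → T i 0) p ≡ false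
      row-even = trans (xorSum-cong p (λ i _ → sym (xor-identityʳ (T i 0)))) (Admissible.even admissible)
      open CycleRanking (proj₁ (cycleRanking-min (λ i → T i 0) a a<p Ta0 row-even))
  ... | _ , suc _ , _ , s≤s () , _

  realise : ∀ m → Realisable (suc m)
  realise zero = oneRow
  realise (suc m) T admissible = Step.ranking m T admissible (realise m)

-- From rankings to orientations of C_p □ P_q

toFin : (k : ℕ) → ℕ → Maybe (Fin k)
toFin zero _ = nothing
toFin (suc k) zero = just fzero
toFin (suc k) (suc i) = Maybe.map fsuc (toFin k i)

toFin-toℕ : ∀ k (x : Fin k) → toFin k (toℕ x) ≡ just x
toFin-toℕ (suc k) fzero = refl
toFin-toℕ (suc k) (fsuc x) = cong (Maybe.map fsuc) (toFin-toℕ k x)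

pathPrev : (ℕ → Bool) → ℕ → Bool
pathPrev h zero = false
pathPrev h (suc j) = h j

pathNext : ℕ → (ℕ → Bool) → ℕ → Bool
pathNext q h j = if suc j <ᵇ q then h (suc j) else false

xorSum-pathAdj : ∀ q j (h : ℕ → Bool) → j < q → xorSum (λ b → pathAdj b j ∧ h b) q ≡ pathPrev h j xor pathNext q h j
xorSum-pathAdj q j h j<q = begin
    xorSum (λ b → pathAdj b j ∧ h b) q
      ≡⟨ xorSum-cong q (λ b _ → ∨-∧-disjoint (suc b ≡ᵇ j) (suc j ≡ᵇ b) (h b) (disjoint b)) ⟩
    xorSum (λ b → ((suc b ≡ᵇ j) ∧ h b) xor ((suc j ≡ᵇ b) ∧ h b)) q
      ≡⟨ xorSum-xor q (λ b → (suc b ≡ᵇ j) ∧ h b) (λ b → (suc j ≡ᵇ b) ∧ h b) ⟩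
    xorSum (λ b → (suc b ≡ᵇ j) ∧ h b) q xor xorSum (λ b → (suc j ≡ᵇ b) ∧ h b) q
      ≡⟨ cong₂ _xor_ (below j j<q) (trans (xorSum-cong q (λ b _ → cong (_∧ h b) (≡ᵇ-comm (suc j) b))) above) ⟩
    pathPrev h j xor pathNext q h j  ∎
  where
    open ≡-Reasoning
    disjoint : ∀ b → (suc b ≡ᵇ j) ∧ (suc j ≡ᵇ b) ≡ false
    disjoint b with suc b ≡ᵇ j in b+1≡j
    ... | false = refl
    ... | true = ≡ᵇ-false {suc j} {b} (λ j+1≡b →
      <⇒≢ (<-trans (n<1+n j) (n<1+n (suc j))) (sym (trans (cong suc j+1≡b) (≡ᵇ-sound {suc b} {j} b+1≡j))))
    below : ∀ j → j < q → xorSum (λ b → (suc b ≡ᵇ j) ∧ h b) q ≡ pathPrev h j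
    below zero _ = xorSum-false q
    below (suc j) j+1<q = xorSum-point q j h (<-trans (n<1+n j) j+1<q)
    above : xorSum (λ b → (b ≡ᵇ suc j) ∧ h b) q ≡ pathNext q h j
    above with suc j <ᵇ q in j+1<ᵇq
    ... | true = xorSum-point q (suc j) h (<ᵇ-sound j+1<ᵇq)
    ... | false = xorSum-beyond q (suc j) h (≮⇒≥ (λ j+1<q → true≢false (trans (sym (<ᵇ-true j+1<q)) j+1<ᵇq)))

module Orientation (n : ℕ) (n-even : parity n ≡ false) (m : ℕ) where
  open Induction n n-even public

  q : ℕ
  q = suc m

  toGrid : (V p q → Bool) → Grid
  toGrid S i j = maybe (λ x → maybe (λ y → S (x , y)) false (toFin q j)) false (toFin p i)

  toGrid-toℕ : ∀ S (x : Fin p) (y : Fin q) → toGrid S (toℕ x) (toℕ y) ≡ S (x , y)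
  toGrid-toℕ S x y rewrite toFin-toℕ p x | toFin-toℕ q y = refl

  cycAdj-self : ∀ i → i < p → cycAdj p i i ≡ false
  cycAdj-self i i<p = cong₂ _∨_ (≡ᵇ-false (next≢ i i<p)) (≡ᵇ-false (next≢ i i<p))

  cycAdj-neighbours : ∀ a i → a < p → i < p → cycAdj p a i ≡ (a ≡ᵇ prev i) ∨ (a ≡ᵇ next i)
  cycAdj-neighbours a i a<p i<p = cong₂ _∨_ next-a (≡ᵇ-comm (next i) a)
    where
      next-a : (next a ≡ᵇ i) ≡ (a ≡ᵇ prev i)
      next-a with a ≡ᵇ prev i in a≡prev
      ... | true = trans (cong (λ k → next k ≡ᵇ i) (≡ᵇ-sound {a} {prev i} a≡prev)) (trans (cong (_≡ᵇ i) (next-prev i i<p)) (≡ᵇ-refl i))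
      ... | false = ≡ᵇ-false {next a} {i} (λ next-a≡i → ≡ᵇ-false⇒≢ {a} {prev i} a≡prev (trans (sym (prev-next a a<p)) (cong prev next-a≡i)))

  xorSum-cycAdj : ∀ i (G : ℕ → Bool) → i < p → xorSum (λ a → cycAdj p a i ∧ G a) p ≡ G (prev i) xor G (next i)
  xorSum-cycAdj i G i<p = begin
      xorSum (λ a → cycAdj p a i ∧ G a) p
        ≡⟨ xorSum-cong p (λ a a<p → trans (cong (_∧ G a) (cycAdj-neighbours a i a<p i<p))
                                          (∨-∧-disjoint (a ≡ᵇ prev i) (a ≡ᵇ next i) (G a) (disjoint a))) ⟩
      xorSum (λ a → ((a ≡ᵇ prev i) ∧ G a) xor ((a ≡ᵇ next i) ∧ G a)) p
        ≡⟨ xorSum-xor p (λ a → (a ≡ᵇ prev i) ∧ G a) (λ a → (a ≡ᵇ next i) ∧ G a) ⟩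
      xorSum (λ a → (a ≡ᵇ prev i) ∧ G a) p xor xorSum (λ a → (a ≡ᵇ next i) ∧ G a) p
        ≡⟨ cong₂ _xor_ (xorSum-point p (prev i) G (prev<p i i<p)) (xorSum-point p (next i) G (next<p i)) ⟩
      G (prev i) xor G (next i)  ∎
    where
      open ≡-Reasoning
      disjoint : ∀ a → (a ≡ᵇ prev i) ∧ (a ≡ᵇ next i) ≡ false
      disjoint a with a ≡ᵇ prev i in a≡prev
      ... | false = refl
      ... | true = ≡ᵇ-false {a} {next i} (λ a≡next → prev≢next i i<p (trans (sym (≡ᵇ-sound {a} {prev i} a≡prev)) a≡next))

  neighbourXor : (ℕ → ℕ → Bool) → ℕ → ℕ → Bool
  neighbourXor g i j = (g (prev i) j xor g (next i) j) xor (pathPrev (g i) j xor pathNext q (g i) j)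

  xorSum-adj : ∀ (g : ℕ → ℕ → Bool) i j a → i < p → j < q → a < p →
    xorSum (λ b → (((b ≡ᵇ j) ∧ cycAdj p a i) ∨ ((a ≡ᵇ i) ∧ pathAdj b j)) ∧ g a b) q
      ≡ (cycAdj p a i ∧ g a j) xor ((a ≡ᵇ i) ∧ (pathPrev (g i) j xor pathNext q (g i) j))
  xorSum-adj g i j a i<p j<q a<p = begin
      xorSum (λ b → (((b ≡ᵇ j) ∧ C) ∨ ((a ≡ᵇ i) ∧ pathAdj b j)) ∧ g a b) q
        ≡⟨ xorSum-cong q (λ b _ → trans (∨-∧-disjoint ((b ≡ᵇ j) ∧ C) ((a ≡ᵇ i) ∧ pathAdj b j) (g a b) (disjoint b))
                                        (cong (_xor (((a ≡ᵇ i) ∧ pathAdj b j) ∧ g a b)) (∧-assoc (b ≡ᵇ j) C (g a b)))) ⟩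
      xorSum (λ b → ((b ≡ᵇ j) ∧ (C ∧ g a b)) xor (((a ≡ᵇ i) ∧ pathAdj b j) ∧ g a b)) q
        ≡⟨ xorSum-xor q (λ b → (b ≡ᵇ j) ∧ (C ∧ g a b)) (λ b → ((a ≡ᵇ i) ∧ pathAdj b j) ∧ g a b) ⟩
      xorSum (λ b → (b ≡ᵇ j) ∧ (C ∧ g a b)) q xor xorSum (λ b → ((a ≡ᵇ i) ∧ pathAdj b j) ∧ g a b) q
        ≡⟨ cong₂ _xor_ (xorSum-point q j (λ b → C ∧ g a b) j<q) same-column ⟩
      (C ∧ g a j) xor ((a ≡ᵇ i) ∧ (pathPrev (g i) j xor pathNext q (g i) j))  ∎
    where
      open ≡-Reasoning
      C = cycAdj p a i
      disjoint : ∀ b → ((b ≡ᵇ j) ∧ C) ∧ ((a ≡ᵇ i) ∧ pathAdj b j) ≡ false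
      disjoint b with a ≡ᵇ i in a≡i
      ... | false = ∧-zeroʳ _
      ... | true = cong (_∧ pathAdj b j) (trans (cong (λ k → (b ≡ᵇ j) ∧ cycAdj p k i) (≡ᵇ-sound a≡i))
                                                (trans (cong ((b ≡ᵇ j) ∧_) (cycAdj-self i i<p)) (∧-zeroʳ _)))
      same-column : xorSum (λ b → ((a ≡ᵇ i) ∧ pathAdj b j) ∧ g a b) q ≡ (a ≡ᵇ i) ∧ (pathPrev (g i) j xor pathNext q (g i) j)
      same-column with a ≡ᵇ i in a≡i
      ... | false = xorSum-false q
      ... | true = trans (cong (λ k → xorSum (λ b → pathAdj b j ∧ g k b) q) (≡ᵇ-sound a≡i)) (xorSum-pathAdj q j (g i) j<q)

  xorList-neighbours : ∀ (g : ℕ → ℕ → Bool) (x : Fin p) (y : Fin q) →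
    xorList (λ u → adj p q u (x , y) ∧ g (toℕ (proj₁ u)) (toℕ (proj₂ u))) (vertices p q) ≡ neighbourXor g (toℕ x) (toℕ y)
  xorList-neighbours g x y = begin
      xorList (λ u → adj p q u (x , y) ∧ g (toℕ (proj₁ u)) (toℕ (proj₂ u))) (cartesianProduct (allFin p) (allFin q))
        ≡⟨ xorList-cartesianProduct (λ u → adj p q u (x , y) ∧ g (toℕ (proj₁ u)) (toℕ (proj₂ u))) (allFin p) (allFin q) ⟩
      xorList (λ a → xorList (λ b → F (toℕ a) (toℕ b)) (allFin q)) (allFin p)
        ≡⟨ xorList-cong (allFin p) (λ a → xorList-allFin q (F (toℕ a))) ⟩
      xorList (λ a → xorSum (F (toℕ a)) q) (allFin p)
        ≡⟨ xorList-allFin p (λ a → xorSum (F a) q) ⟩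
      xorSum (λ a → xorSum (F a) q) p
        ≡⟨ xorSum-cong p (λ a a<p → xorSum-adj g i j a i<p j<q a<p) ⟩
      xorSum (λ a → (cycAdj p a i ∧ g a j) xor ((a ≡ᵇ i) ∧ D)) p
        ≡⟨ xorSum-xor p (λ a → cycAdj p a i ∧ g a j) (λ a → (a ≡ᵇ i) ∧ D) ⟩
      xorSum (λ a → cycAdj p a i ∧ g a j) p xor xorSum (λ a → (a ≡ᵇ i) ∧ D) p
        ≡⟨ cong₂ _xor_ (xorSum-cycAdj i (λ a → g a j) i<p) (xorSum-point p i (λ _ → D) i<p) ⟩
      neighbourXor g i j  ∎
    where
      open ≡-Reasoning
      i = toℕ x
      j = toℕ y
      i<p = toℕ<n x
      j<q = toℕ<n y
      D = pathPrev (g i) j xor pathNext q (g i) j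
      F : ℕ → ℕ → Bool
      F a b = (((b ≡ᵇ j) ∧ cycAdj p a i) ∨ ((a ≡ᵇ i) ∧ pathAdj b j)) ∧ g a b

  pathDegree : ℕ → ℕ → Bool
  pathDegree q′ j = pathPrev (λ _ → true) j xor pathNext q′ (λ _ → true) j

  odd-deg : ∀ (x : Fin p) (y : Fin q) → odd (deg p q (x , y)) ≡ pathDegree q (toℕ y)
  odd-deg x y = begin
      odd (deg p q (x , y))                                           ≡⟨ odd≡parity (deg p q (x , y)) ⟩
      parity (count (λ u → adj p q u (x , y)) (vertices p q))         ≡⟨ parity-count (λ u → adj p q u (x , y)) (vertices p q) ⟩
      xorList (λ u → adj p q u (x , y)) (vertices p q)
        ≡⟨ xorList-cong (vertices p q) (λ u → sym (∧-identityʳ (adj p q u (x , y)))) ⟩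
      xorList (λ u → adj p q u (x , y) ∧ true) (vertices p q)         ≡⟨ xorList-neighbours (λ _ _ → true) x y ⟩
      pathDegree q (toℕ y)                                            ∎
    where open ≡-Reasoning

  pathDegree≡boundaryRow : ∀ q′ j → 1 < q′ → j < q′ → pathDegree q′ j ≡ boundaryRow q′ j
  pathDegree≡boundaryRow q′ zero 1<q′ _ = if-true (<ᵇ-true 1<q′)
  pathDegree≡boundaryRow q′ (suc j) _ j+1<q′ = begin
      not (if suc (suc j) <ᵇ q′ then true else false)  ≡⟨ cong not (if-id (suc (suc j) <ᵇ q′)) ⟩
      not (suc (suc j) <ᵇ q′)                          ≡⟨ not-<ᵇ j+1<q′ ⟩
      (suc (suc j) ≡ᵇ q′)                              ∎
    where
      open ≡-Reasoning
      not-<ᵇ : ∀ {k l} → k ≤ l → not (k <ᵇ l) ≡ (k ≡ᵇ l)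
      not-<ᵇ {zero} {zero} _ = refl
      not-<ᵇ {zero} {suc l} _ = refl
      not-<ᵇ {suc k} {suc l} (s≤s k≤l) = not-<ᵇ k≤l

  sink-at : ∀ m′ (G : Grid) i j → i < p → j < suc m′ → G i j ≡ pathDegree (suc m′) j → HasSink (suc m′) G
  sink-at zero G i j _ _ _ = tt
  sink-at (suc m′) G i j i<p j<q Gij = i , j , i<p , j<q , trans Gij (pathDegree≡boundaryRow (suc (suc m′)) j (s≤s (s≤s z≤n)) j<q)

  forward : ℕ → Bool
  forward i = (i <ᵇ prev i) xor (i <ᵇ next i)

  xorSum-forward : xorSum forward p ≡ false
  xorSum-forward = begin
      xorSum (λ k → forward (suc k)) p-1                         ≡⟨ xorSum-snoc p-2 (λ k → forward (suc k)) ⟩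
      xorSum (λ k → forward (suc k)) p-2 xor forward p-1
        ≡⟨ cong₂ _xor_ (xorSum-cong p-2 (λ k k<p-2 → inner k k<p-2)) last ⟩
      xorSum (λ _ → true) p-2 xor false                          ≡⟨ xor-identityʳ _ ⟩
      xorSum (λ _ → true) p-2                                    ≡⟨ xorSum-const p-2 true ⟩
      not (not (parity n))                                       ≡⟨ not-involutive (parity n) ⟩
      parity n                                                   ≡⟨ n-even ⟩
      false                                                      ∎
    where
      open ≡-Reasoning
      inner : ∀ k → k < p-2 → forward (suc k) ≡ true
      inner k k<p-2 = cong₂ _xor_ (<ᵇ-false (n≤1+n k))
                                  (trans (cong (suc k <ᵇ_) (next-suc (suc k) (s≤s (s≤s k<p-2)))) (<ᵇ-true (n<1+n (suc k))))
      last : forward p-1 ≡ false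
      last = cong₂ _xor_ (<ᵇ-false (n≤1+n p-2)) (cong (p-1 <ᵇ_) next-last)

  neighbourXor-key : ∀ i j → neighbourXor (λ a b → (j * p + i) <ᵇ (b * p + a)) i j ≡ forward i xor (suc j <ᵇ q)
  neighbourXor-key i j = cong₂ _xor_ (cong₂ _xor_ (<ᵇ-+ˡ (j * p) i (prev i)) (<ᵇ-+ˡ (j * p) i (next i)))
                                     (cong₂ _xor_ (below j) (trans (cong (λ b → if suc j <ᵇ q then b else false) above)
                                                                   (if-id (suc j <ᵇ q))))
    where
      below : ∀ j → pathPrev (λ b → (j * p + i) <ᵇ (b * p + i)) j ≡ false
      below zero = refl
      below (suc j) = <ᵇ-false (+-monoˡ-≤ i (m≤n+m (j * p) p))
      above : (j * p + i <ᵇ suc j * p + i) ≡ true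
      above = <ᵇ-true (+-monoˡ-< i (m<n+m (j * p) {p} z<s))

  xorList-vertices : ∀ (G : Grid) → xorList (λ u → G (toℕ (proj₁ u)) (toℕ (proj₂ u))) (vertices p q) ≡ totalParity q G
  xorList-vertices G = begin
      xorList (λ u → G (toℕ (proj₁ u)) (toℕ (proj₂ u))) (cartesianProduct (allFin p) (allFin q))
        ≡⟨ xorList-cartesianProduct (λ u → G (toℕ (proj₁ u)) (toℕ (proj₂ u))) (allFin p) (allFin q) ⟩
      xorList (λ x → xorList (λ y → G (toℕ x) (toℕ y)) (allFin q)) (allFin p)
        ≡⟨ xorList-cong (allFin p) (λ x → xorList-allFin q (G (toℕ x))) ⟩
      xorList (λ x → xorSum (G (toℕ x)) q) (allFin p)
        ≡⟨ xorList-allFin p (λ i → xorSum (G i) q) ⟩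
      totalParity q G  ∎
    where open ≡-Reasoning

  parity-card : ∀ S → parity (card p q S) ≡ totalParity q (toGrid S)
  parity-card S = begin
      parity (card p q S)       ≡⟨ parity-count S (vertices p q) ⟩
      xorList S (vertices p q)  ≡⟨ xorList-cong (vertices p q) (λ u → sym (toGrid-toℕ S (proj₁ u) (proj₂ u))) ⟩
      xorList (λ u → toGrid S (toℕ (proj₁ u)) (toℕ (proj₂ u))) (vertices p q)  ≡⟨ xorList-vertices (toGrid S) ⟩
      totalParity q (toGrid S)  ∎
    where open ≡-Reasoning

  adj-sym : ∀ u w → adj p q u w ≡ adj p q w u
  adj-sym (i , j) (i′ , j′) =
    cong₂ _∨_ (cong₂ _∧_ (≡ᵇ-comm (toℕ j) (toℕ j′)) (∨-comm (next (toℕ i) ≡ᵇ toℕ i′) (next (toℕ i′) ≡ᵇ toℕ i)))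
              (cong₂ _∧_ (≡ᵇ-comm (toℕ i) (toℕ i′)) (∨-comm (suc (toℕ j) ≡ᵇ toℕ j′) (suc (toℕ j′) ≡ᵇ toℕ j)))

  -- Each edge is counted at its endpoint of smaller key, so every vertex contributes its forward
  -- neighbours: one in the cycle except at columns 0 and p - 1, and one in the path below row q - 1.
  numEdges-even : parity (numEdges p q) ≡ false
  numEdges-even = begin
      parity (numEdges p q)
        ≡⟨ parity-count arc (cartesianProduct (vertices p q) (vertices p q)) ⟩
      xorList arc (cartesianProduct (vertices p q) (vertices p q))
        ≡⟨ xorList-cartesianProduct arc (vertices p q) (vertices p q) ⟩
      xorList (λ u → xorList (λ w → arc (u , w)) (vertices p q)) (vertices p q)
        ≡⟨ xorList-cong (vertices p q) (λ u → forward-neighbours (proj₁ u) (proj₂ u)) ⟩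
      xorList (λ u → forward (toℕ (proj₁ u)) xor (suc (toℕ (proj₂ u)) <ᵇ q)) (vertices p q)
        ≡⟨ xorList-vertices (λ i j → forward i xor (suc j <ᵇ q)) ⟩
      xorSum (λ i → xorSum (λ j → forward i xor (suc j <ᵇ q)) q) p
        ≡⟨ xorSum-cong p (λ i _ → trans (xorSum-xor q (λ _ → forward i) (λ j → suc j <ᵇ q))
                                         (cong (_xor xorSum (λ j → suc j <ᵇ q) q) (xorSum-const q (forward i)))) ⟩
      xorSum (λ i → (forward i ∧ parity q) xor xorSum (λ j → suc j <ᵇ q) q) p
        ≡⟨ xorSum-xor p (λ i → forward i ∧ parity q) (λ _ → xorSum (λ j → suc j <ᵇ q) q) ⟩
      xorSum (λ i → forward i ∧ parity q) p xor xorSum (λ _ → xorSum (λ j → suc j <ᵇ q) q) p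
        ≡⟨ cong₂ _xor_ (trans (xorSum-∧ʳ p forward (parity q)) (cong (_∧ parity q) xorSum-forward))
                       (xorSum-const-p (xorSum (λ j → suc j <ᵇ q) q)) ⟩
      false  ∎
    where
      open ≡-Reasoning
      arc : V p q × V p q → Bool
      arc e = adj p q (proj₁ e) (proj₂ e) ∧ (key p q (proj₁ e) <ᵇ key p q (proj₂ e))
      forward-neighbours : ∀ (x : Fin p) (y : Fin q) →
        xorList (λ w → arc ((x , y) , w)) (vertices p q) ≡ forward (toℕ x) xor (suc (toℕ y) <ᵇ q)
      forward-neighbours x y =
        trans (xorList-cong (vertices p q) (λ w → cong (_∧ (key p q (x , y) <ᵇ key p q w)) (adj-sym (x , y) w)))
              (trans (xorList-neighbours (λ a b → key p q (x , y) <ᵇ (b * p + a)) x y) (neighbourXor-key (toℕ x) (toℕ y)))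

  -- Only the non-emptiness parts of (S) and (S̄) are needed.
  admissible : ∀ S → CondP p q S → CondS p q S → CondSbar p q S → Admissible q (toGrid S)
  admissible S condP (sources≢0 , _) (sinks≢0 , _) = record
    { even = even
    ; source = toℕ xs , toℕ ys , toℕ<n xs , toℕ<n ys , trans (toGrid-toℕ S xs ys) (not-injective source)
    ; sink = sink-at m (toGrid S) (toℕ xk) (toℕ yk) (toℕ<n xk) (toℕ<n yk)
               (trans (toGrid-toℕ S xk yk) (trans (sink⇒≡ (S (xk , yk)) _ sink) (odd-deg xk yk)))
    }
    where
      open ≡-Reasoning
      even : totalParity q (toGrid S) ≡ false
      even = begin
          totalParity q (toGrid S)                       ≡⟨ parity-card S ⟨
          parity (card p q S)                            ≡⟨ cong (_xor parity (card p q S)) numEdges-even ⟨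
          parity (numEdges p q) xor parity (card p q S)  ≡⟨ parity-+ (numEdges p q) (card p q S) ⟨
          parity (numEdges p q + card p q S)             ≡⟨ odd≡parity (numEdges p q + card p q S) ⟨
          odd (numEdges p q + card p q S)                ≡⟨ cong (_≡ᵇ 1) condP ⟩
          false                                          ∎
      xs = proj₁ (proj₁ (count-nonzero (Source p q S) (vertices p q) sources≢0))
      ys = proj₂ (proj₁ (count-nonzero (Source p q S) (vertices p q) sources≢0))
      source = proj₂ (count-nonzero (Source p q S) (vertices p q) sources≢0)
      xk = proj₁ (proj₁ (count-nonzero (Sink p q S) (vertices p q) sinks≢0))
      yk = proj₂ (proj₁ (count-nonzero (Sink p q S) (vertices p q) sinks≢0))
      sink = proj₂ (count-nonzero (Sink p q S) (vertices p q) sinks≢0)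
      sink⇒≡ : ∀ a b → (a ∧ b) ∨ (not a ∧ not b) ≡ true → a ≡ b
      sink⇒≡ false false _ = refl
      sink⇒≡ true true _ = refl

  module RankOrientation (S : V p q → Bool) (ρ : Ranking q (toGrid S)) where
    open Ranking ρ

    rankOf : V p q → ℕ
    rankOf u = rank (toℕ (proj₁ u)) (toℕ (proj₂ u))

    O : V p q → V p q → Bool
    O u w = adj p q u w ∧ (rankOf u <ᵇ rankOf w)

    adj⇒rank≢ : ∀ u w → adj p q u w ≡ true → rankOf u ≢ rankOf w
    adj⇒rank≢ (x , y) (x′ , y′) uw with ∨≡true uw
    ... | inj₁ row with ∧≡true row
    ...   | y≡y′ , cyc with ∨≡true cyc
    ...     | inj₁ x→x′ = λ eq → rank-next≢ (toℕ x) (toℕ y) (toℕ<n x) (toℕ<n y)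
                (sym (trans eq (cong₂ rank (sym (≡ᵇ-sound x→x′)) (sym (≡ᵇ-sound y≡y′)))))
    ...     | inj₂ x′→x = λ eq → rank-next≢ (toℕ x′) (toℕ y′) (toℕ<n x′) (toℕ<n y′)
                (trans (cong₂ rank (≡ᵇ-sound x′→x) (sym (≡ᵇ-sound y≡y′))) eq)
    adj⇒rank≢ (x , y) (x′ , y′) uw | inj₂ column with ∧≡true column
    ...   | x≡x′ , path with ∨≡true path
    ...     | inj₁ y→y′ = λ eq → rank-up≢ (toℕ x) (toℕ y) (toℕ<n x) (subst (_< q) (sym (≡ᵇ-sound y→y′)) (toℕ<n y′))
                (sym (trans eq (cong₂ rank (sym (≡ᵇ-sound x≡x′)) (sym (≡ᵇ-sound y→y′)))))
    ...     | inj₂ y′→y = λ eq → rank-up≢ (toℕ x′) (toℕ y′) (toℕ<n x′) (subst (_< q) (sym (≡ᵇ-sound y′→y)) (toℕ<n y))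
                (trans (cong₂ rank (sym (≡ᵇ-sound x≡x′)) (≡ᵇ-sound y′→y)) eq)

    O-flip : ∀ u w → adj p q u w ≡ true → O w u ≡ not (rankOf u <ᵇ rankOf w)
    O-flip u w uw = cong₂ _∧_ (trans (adj-sym w u) uw) (<ᵇ-flip (adj⇒rank≢ u w uw))

    isOrientation : IsOrientation p q O
    isOrientation = (λ u w uw → proj₁ (∧≡true uw)) , oriented
      where
        oriented : ∀ u w → adj p q u w ≡ true → (O u w ≡ true × O w u ≡ false) ⊎ (O u w ≡ false × O w u ≡ true)
        oriented u w uw with rankOf u <ᵇ rankOf w in u<w
        ... | true = inj₁ (cong (_∧ true) uw , trans (O-flip u w uw) (cong not u<w))
        ... | false = inj₂ (cong (_∧ false) uw , trans (O-flip u w uw) (cong not u<w))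

    rank-increases : ∀ {u w} → TransClosure (Arc p q O) u w → rankOf u < rankOf w
    rank-increases [ uw ] = <ᵇ-sound (proj₂ (∧≡true uw))
    rank-increases (uv ∷ vw) = <-trans (<ᵇ-sound (proj₂ (∧≡true uv))) (rank-increases vw)

    isAcyclic : IsAcyclic p q O
    isAcyclic v cycle = <-irrefl refl (rank-increases cycle)

    inParity≡neighbourXor : ∀ i j → inParity q rank i j ≡ neighbourXor (λ a b → rank a b <ᵇ rank i j) i j
    inParity≡neighbourXor i zero = refl
    inParity≡neighbourXor i (suc j) = refl

    odd-indeg : ∀ v → odd (indeg p q O v) ≡ S v
    odd-indeg (x , y) = begin
        odd (indeg p q O (x , y))                                 ≡⟨ odd≡parity (indeg p q O (x , y)) ⟩
        parity (count (λ u → O u (x , y)) (vertices p q))         ≡⟨ parity-count (λ u → O u (x , y)) (vertices p q) ⟩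
        xorList (λ u → O u (x , y)) (vertices p q)                ≡⟨ xorList-neighbours (λ a b → rank a b <ᵇ rank i j) x y ⟩
        neighbourXor (λ a b → rank a b <ᵇ rank i j) i j           ≡⟨ inParity≡neighbourXor i j ⟨
        inParity q rank i j                                       ≡⟨ inParity≡ i j (toℕ<n x) (toℕ<n y) ⟩
        toGrid S i j                                              ≡⟨ toGrid-toℕ S x y ⟩
        S (x , y)                                                 ∎
      where
        open ≡-Reasoning
        i = toℕ x
        j = toℕ y

    isTOdd : IsTOdd p q S O
    isTOdd v = (λ odd≡true → trans (sym (odd-indeg v)) odd≡true) , (λ Sv≡true → trans (odd-indeg v) Sv≡true)

  theorem : ∀ S → CondP p q S → CondS p q S → CondSbar p q S →
            Σ (V p q → V p q → Bool) (λ O → IsOrientation p q O × IsTOdd p q S O × IsAcyclic p q O)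
  theorem S condP condS condSbar = O , isOrientation , isTOdd , isAcyclic
    where open RankOrientation S (realise m (toGrid S) (admissible S condP condS condSbar))

lemma11 : (p q : ℕ) → 4 ≤ p → p % 2 ≡ 0 → 1 ≤ q →
          (T : Subset p q) → CondP p q T → CondS p q T → CondSbar p q T →
          Σ (V p q → V p q → Bool) (λ O →
            IsOrientation p q O × IsTOdd p q T O × IsAcyclic p q O)
lemma11 (suc (suc (suc (suc n)))) (suc m) (s≤s (s≤s (s≤s (s≤s z≤n)))) p%2≡0 (s≤s z≤n) =
  Orientation.theorem n n-even m
  where
    n-even : parity n ≡ false
    n-even = begin
        parity n                                   ≡⟨ trans (not-involutive (not (not (parity n)))) (not-involutive (parity n)) ⟨
        parity (suc (suc (suc (suc n))))           ≡⟨ odd≡parity (suc (suc (suc (suc n)))) ⟨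
        odd (suc (suc (suc (suc n))))              ≡⟨ cong (_≡ᵇ 1) p%2≡0 ⟩
        false                                      ∎
      where open ≡-Reasoning
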